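{- Let $q=p^n$ be a power of an odd prime with $q\equiv 3\pmod 4$, let $u\in\mathbb{F}_q\setminus\{0,\pm1\}$ and $F_{2,u}(x)=x^2\big(1+u\eta(x)\big)$. Then $\delta_{F_{2,u}}\le 5$. Moreover: (1) if $\eta(1+u)=\eta(1-u)$, then $\delta_{F_{2,u}}\le 4$; (2) if $\eta(1+u)=\eta(u-1)=\eta(u)$, then for any $b\in\mathbb{F}_q$, $\delta_{F_{2,u}}(1,b)=5$ if and only if $\#A_{00}(b)=\#A_{11}(b)=\#A_{10}(b)=1$ and $\#A_{01}(b)=2$; (3) if $\eta(1+u)=\eta(u-1)=-\eta(u)$, then for any $b\in\mathbb{F}_q$, $\delta_{F_{2,u}}(1,b)=5$ if and only if $\#A_{00}(b)=\#A_{11}(b)=\#A_{01}(b)=1$ and $\#A_{10}(b)=2$.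
   Context: $\eta$ is the quadratic character of $\mathbb{F}_q$ ($\eta(0)=0$, $\eta=1$ on nonzero squares, $-1$ on non-squares). $C_{00}=\{x:\eta(x)=\eta(x+1)=1\}$, $C_{01}=\{x:\eta(x)=1,\eta(x+1)=-1\}$, $C_{10}=\{x:\eta(x)=-1,\eta(x+1)=1\}$, $C_{11}=\{x:\eta(x)=\eta(x+1)=-1\}$. For $i,j\in\{0,1\}$ and $b\in\mathbb{F}_q$, $A_{ij}(b)=\{x\in C_{ij}: F_{2,u}(x+1)-F_{2,u}(x)=b\}$. For $f$ on $\mathbb{F}_q$, $\delta_f(a,b)=\#\{x\in\mathbb{F}_q: f(x+a)-f(x)=b\}$ and $\delta_f=\max_{a\ne0,b}\delta_f(a,b)$. -}

module Defs where

open import Level using (0ℓ)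
open import Data.Nat as ℕ using (ℕ; _⊔_)
open import Data.Integer as ℤ using (ℤ; +_; -[1+_])
open import Data.List using (List; length; filter; foldr; map)
open import Data.List.Membership.Propositional using (_∈_)
open import Data.List.Relation.Unary.Unique.Propositional using (Unique)
open import Data.List.Relation.Unary.Any using (Any; any?)
open import Data.Product using (Σ; ∃; _×_; _,_)
open import Relation.Nullary using (¬_; Dec; yes; no)
open import Relation.Nullary.Decidable using (_×-dec_)
open import Relation.Binary.PropositionalEquality using (_≡_; _≢_)
open import Algebra.Structures using (IsCommutativeRing)

record FiniteField : Set₁ where
  infixl 6 _+_ _-_
  infixl 7 _*_
  field
    Carrier : Set
    _+_ _*_ : Carrier → Carrier → Carrier
    -_      : Carrier → Carrier
    0# 1#   : Carrier
    isCommutativeRing : IsCommutativeRing _≡_ _+_ _*_ -_ 0# 1#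
    0≢1     : 0# ≢ 1#
    inverse : ∀ x → x ≢ 0# → ∃ λ y → x * y ≡ 1#
    _≟_     : (x y : Carrier) → Dec (x ≡ y)
    elems   : List Carrier
    elems-unique   : Unique elems
    elems-complete : ∀ x → x ∈ elems

  _-_ : Carrier → Carrier → Carrier
  x - y = x + (- y)

  card : ℕ
  card = length elems

module _ (F : FiniteField) where
  open FiniteField F

  η : Carrier → ℤ
  η x with x ≟ 0#
  ... | yes _ = + 0
  ... | no _ with any? (λ y → (y * y) ≟ x) elems
  ...   | yes _ = + 1
  ...   | no _  = -[1+ 0 ]

  ηF : Carrier → Carrier
  ηF x with η x
  ... | + 0 = 0#
  ... | + _ = 1#
  ... | -[1+ _ ] = - 1#

  F2 : Carrier → Carrier → Carrier
  F2 u x = (x * x) * (1# + u * ηF x)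

  δ : (Carrier → Carrier) → Carrier → Carrier → ℕ
  δ f a b = length (filter (λ x → (f (x + a) - f x) ≟ b) elems)

  δmax : (Carrier → Carrier) → ℕ
  δmax f = foldr _⊔_ 0
    (map (λ a → foldr _⊔_ 0 (map (λ b → δ f a b) elems))
         (filter (λ a → Relation.Nullary.Decidable.¬? (a ≟ 0#)) elems))

  -- s i = η-value of class index i : 0 ↦ 1 (square), 1 ↦ -1 (non-square)
  sgn : ℕ → ℤ
  sgn 0 = + 1
  sgn _ = -[1+ 0 ]

  #A : Carrier → ℕ → ℕ → Carrier → ℕ
  #A u i j b = length (filter
    (λ x → (η x ℤ.≟ sgn i) ×-dec ((η (x + 1#) ℤ.≟ sgn j) ×-dec
           ((F2 u (x + 1#) - F2 u x) ≟ b)))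
    elems)

-- For x ∉ {0, -1} the difference D x = F (x + 1) - F x depends only on the class C_ij of x:
-- it is linear with nonzero slope on C₀₀ and C₁₁ and quadratic with nonzero leading coefficient
-- on C₀₁ and C₁₀, so these classes contain at most 1, 1, 2 and 2 solutions of D x = b.  Through
-- Vieta's formulas, a solution in a linear class, or two solutions in a quadratic class, fix the
-- quadratic characters of b ∓ (1 + u) and b ∓ (1 - u).  Comparing these excludes every
-- configuration with more than five solutions, and with exactly five forces #A₀₀ = #A₁₁ = 1 and
-- {#A₀₁, #A₁₀} = {2, 1}, the order being decided by η(1 + u) = ± η(u).  Multiplicativity of η
-- and η(-1) = -1 (for q ≡ 3 mod 4) come from counting squares; the latter writes every
-- direction as a = ± c with η(c) = 1, and x ↦ c x then reduces δ(a, b) to δ(1, b′).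

module Submission where

open import Defs
open import Level using (Level; 0ℓ)
open import Algebra.Bundles using (CommutativeRing)
import Algebra.Solver.Ring.AlmostCommutativeRing as ACR
open import Data.Empty using (⊥; ⊥-elim)
open import Data.Fin using (toℕ)
open import Data.Fin.Properties using (toℕ-injective)
open import Data.Integer as ℤ using (ℤ; -[1+_]; 0ℤ; 1ℤ; -1ℤ)
import Data.Integer.Properties as ℤ
open import Data.List using (List; []; _∷_; length; filter; map; lookup; foldr)
open import Data.List.Properties using (filter-≐; length-removeAt′; length-map; foldr-preservesᵇ)
open import Data.List.Membership.Propositional using (_∈_; lose)
open import Data.List.Membership.Propositional.Properties using (∈-filter⁺; ∈-filter⁻; ∈-map⁻; ∈-length)
open import Data.List.Relation.Unary.All as All using (All; []; _∷_)
open import Data.List.Relation.Unary.All.Properties using (all-filter; map⁺)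
open import Data.List.Relation.Unary.AllPairs using ([]; _∷_)
open import Data.List.Relation.Unary.Any using (here; there; index; _─_; any?; satisfied)
open import Data.List.Relation.Unary.Any.Properties using (lookup-index)
open import Data.List.Relation.Unary.Unique.Propositional using (Unique)
import Data.List.Relation.Unary.Unique.Propositional.Properties as Unique
open import Data.Maybe using (Maybe; just; nothing)
open import Data.Nat as ℕ using (ℕ; zero; suc; _≤_; _<_; _<?_; _%_; _^_; z≤n; s≤s)
import Data.Nat.Properties as ℕ
open import Data.Nat.DivMod using (m∣n⇒o%n%m≡o%m; m*n%n≡0; [m+kn]%n≡m%n)
open import Data.Nat.Divisibility using (divides)
open import Data.Nat.Primality using (Prime)
open import Data.Nat.Tactic.RingSolver using (solve-∀)
open import Data.Product using (∃; ∃₂; _×_; _,_; proj₁; proj₂)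
open import Data.Sign as Sign using (Sign)
open import Data.Unit using (tt)
open import Data.Sum as Sum using (_⊎_; inj₁; inj₂)
open import Function.Bundles using (_⇔_; mk⇔)
open import Relation.Nullary using (¬_; yes; no; ¬?)
open import Relation.Nullary.Decidable using (_×-dec_; decidable-stable)
open import Relation.Unary using (Pred; Decidable; _≐_)
open import Relation.Unary.Properties using (_∩?_; ∁?; U?)
open import Relation.Binary.PropositionalEquality using (_≡_; _≢_; refl; sym; trans; cong; cong₂; subst; module ≡-Reasoning)

module IntegerCoefficients {c ℓ : Level} (R : CommutativeRing c ℓ) where

  open CommutativeRing R renaming (refl to ≈-refl; sym to ≈-sym; trans to ≈-trans; reflexive to ≈-reflexive)
  open import Algebra.Properties.Ring ring using (-‿involutive; -‿+-comm; -‿distribˡ-*; -0#≈0#)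
  open import Algebra.Properties.CommutativeSemigroup +-commutativeSemigroup
    using () renaming (interchange to +-interchange)
  open import Algebra.Properties.CommutativeSemigroup *-commutativeSemigroup
    using () renaming (interchange to *-interchange)
  open import Algebra.Properties.Semiring.Mult.TCOptimised semiring
    using (1+×; ×-homo-+; ×1-homo-*) renaming (_×_ to _·_)
  open import Relation.Binary.Reasoning.Setoid setoid

  -- The TC-optimised multiple makes the images of 1 and 2 evaluate to 1# and
  -- 1# + 1#, so the solver's constants match how these numbers are written.
  ι : ℤ → Carrier
  ι (ℤ.+ n)    = n · 1#
  ι -[1+ n ] = - (suc n · 1#)

  private
    σ : Sign → Carrier
    σ Sign.+ = 1#
    σ Sign.- = - 1#

    σ-homo-* : ∀ s t → σ (s Sign.* t) ≈ σ s * σ t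
    σ-homo-* Sign.+ t      = ≈-sym (*-identityˡ (σ t))
    σ-homo-* Sign.- Sign.+ = ≈-sym (*-identityʳ (- 1#))
    σ-homo-* Sign.- Sign.- = begin
      1#               ≈⟨ -‿involutive 1# ⟨
      - - 1#           ≈⟨ -‿cong (*-identityˡ (- 1#)) ⟨
      - (1# * - 1#)    ≈⟨ -‿distribˡ-* 1# (- 1#) ⟩
      - 1# * - 1#      ∎

    ι-◃ : ∀ s n → ι (s ℤ.◃ n) ≈ σ s * (n · 1#)
    ι-◃ s      zero    = ≈-sym (zeroʳ (σ s))
    ι-◃ Sign.+ (suc n) = ≈-sym (*-identityˡ _)
    ι-◃ Sign.- (suc n) = ≈-trans (-‿cong (≈-sym (*-identityˡ _))) (-‿distribˡ-* 1# _)

    ι-sign-abs : ∀ i → ι i ≈ σ (ℤ.sign i) * (ℤ.∣ i ∣ · 1#)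
    ι-sign-abs i = ≈-trans (≈-reflexive (cong ι (sym (ℤ.◃-inverse i)))) (ι-◃ (ℤ.sign i) ℤ.∣ i ∣)

    cancel-1+ : ∀ x y → (1# + x) - (1# + y) ≈ x - y
    cancel-1+ x y = begin
      (1# + x) + - (1# + y)      ≈⟨ +-congˡ (-‿+-comm 1# y) ⟨
      (1# + x) + (- 1# + - y)    ≈⟨ +-interchange 1# x (- 1#) (- y) ⟩
      (1# + - 1#) + (x + - y)    ≈⟨ +-congʳ (-‿inverseʳ 1#) ⟩
      0# + (x - y)               ≈⟨ +-identityˡ (x - y) ⟩
      x - y                      ∎

    ι-⊖ : ∀ m n → ι (m ℤ.⊖ n) ≈ m · 1# - n · 1#
    ι-⊖ m       zero    = ≈-sym (≈-trans (+-congˡ -0#≈0#) (+-identityʳ _))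
    ι-⊖ zero    (suc n) = ≈-sym (+-identityˡ _)
    ι-⊖ (suc m) (suc n) = begin
      ι (suc m ℤ.⊖ suc n)                ≡⟨ cong ι (ℤ.[1+m]⊖[1+n]≡m⊖n m n) ⟩
      ι (m ℤ.⊖ n)                        ≈⟨ ι-⊖ m n ⟩
      m · 1# - n · 1#                    ≈⟨ cancel-1+ (m · 1#) (n · 1#) ⟨
      (1# + m · 1#) - (1# + n · 1#)      ≈⟨ +-cong (1+× m 1#) (-‿cong (1+× n 1#)) ⟨
      suc m · 1# - suc n · 1#            ∎

    ι-homo-+ : ∀ i j → ι (i ℤ.+ j) ≈ ι i + ι j
    ι-homo-+ (ℤ.+ m)     (ℤ.+ n)     = ×-homo-+ 1# m n
    ι-homo-+ (ℤ.+ m)     -[1+ n ]  = ι-⊖ m (suc n)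
    ι-homo-+ -[1+ m ]  (ℤ.+ n)     = ≈-trans (ι-⊖ n (suc m)) (+-comm _ _)
    ι-homo-+ -[1+ m ]  -[1+ n ]  = begin
      - (suc (suc (m ℕ.+ n)) · 1#)             ≡⟨ cong (λ k → - (suc k · 1#)) (ℕ.+-suc m n) ⟨
      - ((suc m ℕ.+ suc n) · 1#)               ≈⟨ -‿cong (×-homo-+ 1# (suc m) (suc n)) ⟩
      - (suc m · 1# + suc n · 1#)              ≈⟨ -‿+-comm _ _ ⟨
      - (suc m · 1#) + - (suc n · 1#)          ∎

    ι-homo-* : ∀ i j → ι (i ℤ.* j) ≈ ι i * ι j
    ι-homo-* i j = begin
      ι (i ℤ.* j)
        ≈⟨ ι-◃ (ℤ.sign i Sign.* ℤ.sign j) (ℤ.∣ i ∣ ℕ.* ℤ.∣ j ∣) ⟩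
      σ (ℤ.sign i Sign.* ℤ.sign j) * ((ℤ.∣ i ∣ ℕ.* ℤ.∣ j ∣) · 1#)
        ≈⟨ *-cong (σ-homo-* (ℤ.sign i) (ℤ.sign j)) (×1-homo-* ℤ.∣ i ∣ ℤ.∣ j ∣) ⟩
      (σ (ℤ.sign i) * σ (ℤ.sign j)) * ((ℤ.∣ i ∣ · 1#) * (ℤ.∣ j ∣ · 1#))
        ≈⟨ *-interchange _ _ _ _ ⟩
      (σ (ℤ.sign i) * (ℤ.∣ i ∣ · 1#)) * (σ (ℤ.sign j) * (ℤ.∣ j ∣ · 1#))
        ≈⟨ *-cong (ι-sign-abs i) (ι-sign-abs j) ⟨
      ι i * ι j
        ∎

    ι-homo-neg : ∀ i → ι (ℤ.- i) ≈ - ι i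
    ι-homo-neg (ℤ.+ zero)  = ≈-sym -0#≈0#
    ι-homo-neg (ℤ.+ suc n) = ≈-refl
    ι-homo-neg -[1+ n ]  = ≈-sym (-‿involutive _)

    almostCommutativeRing : ACR.AlmostCommutativeRing c ℓ
    almostCommutativeRing = ACR.fromCommutativeRing R

    ι-morphism : ℤ.+-*-rawRing ACR.-Raw-AlmostCommutative⟶ almostCommutativeRing
    ι-morphism = record
      { ⟦_⟧ = ι ; +-homo = ι-homo-+ ; *-homo = ι-homo-* ; -‿homo = ι-homo-neg
      ; 0-homo = ≈-refl ; 1-homo = ≈-refl }

    ι-≟ : ∀ i j → Maybe (ι i ≈ ι j)
    ι-≟ i j with i ℤ.≟ j
    ... | yes refl = just ≈-refl
    ... | no _       = nothing

  open import Algebra.Solver.Ring ℤ.+-*-rawRing almostCommutativeRing ι-morphism ι-≟ public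
    using (solve; _:+_; _:*_; :-_; _:-_; _:=_; con)

module Counting {A : Set} where

  count : {P : Pred A 0ℓ} → Decidable P → List A → ℕ
  count P? xs = length (filter P? xs)

  module _ {P : Pred A 0ℓ} (P? : Decidable P) where

    count-cong : {Q : Pred A 0ℓ} (Q? : Decidable Q) → P ≐ Q → ∀ xs → count P? xs ≡ count Q? xs
    count-cong Q? P≐Q xs = cong length (filter-≐ P? Q? P≐Q xs)

    count-split : {Q : Pred A 0ℓ} (Q? : Decidable Q) →
                  ∀ xs → count P? xs ≡ count (P? ∩? Q?) xs ℕ.+ count (P? ∩? ∁? Q?) xs
    count-split Q? []       = refl
    count-split Q? (x ∷ xs) with P? x | Q? x
    ... | yes _ | yes _ = cong suc (count-split Q? xs)
    ... | yes _ | no _  = trans (cong suc (count-split Q? xs)) (sym (ℕ.+-suc _ _))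
    ... | no _  | yes _ = count-split Q? xs
    ... | no _  | no _  = count-split Q? xs

    count≡0 : (∀ x → ¬ P x) → ∀ xs → count P? xs ≡ 0
    count≡0 ¬P []       = refl
    count≡0 ¬P (x ∷ xs) with P? x
    ... | yes Px = ⊥-elim (¬P x Px)
    ... | no _   = count≡0 ¬P xs

    count≡length : (∀ x → P x) → ∀ xs → count P? xs ≡ length xs
    count≡length P-all []       = refl
    count≡length P-all (x ∷ xs) with P? x
    ... | yes _  = cong suc (count≡length P-all xs)
    ... | no ¬Px = ⊥-elim (¬Px (P-all x))

    count-witness : ∀ xs → 1 ≤ count P? xs → ∃ P
    count-witness xs 1≤count with filter P? xs | all-filter P? xs
    ... | x ∷ _ | Px ∷ _ = x , Px

  count-partition : ∀ {P Q R : Pred A 0ℓ} (P? : Decidable P) (Q? : Decidable Q) (R? : Decidable R) →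
    (∀ {x} → P x → Q x ⊎ R x) → (∀ {x} → Q x → R x → ⊥) →
    ∀ xs → count P? xs ≡ count (P? ∩? Q?) xs ℕ.+ count (P? ∩? R?) xs
  count-partition {P} {Q} {R} P? Q? R? cover disjoint xs = trans (count-split P? Q? xs) (cong (count (P? ∩? Q?) xs ℕ.+_)
    (count-cong (P? ∩? ∁? Q?) (P? ∩? R?) (to , λ (Px , Rx) → Px , λ Qx → disjoint Qx Rx) xs))
    where
    to : ∀ {x} → P x × ¬ Q x → P x × R x
    to (Px , ¬Qx) with cover Px
    ... | inj₁ Qx = ⊥-elim (¬Qx Qx)
    ... | inj₂ Rx = Px , Rx

  private
    ∈-─ : ∀ {x y : A} {zs} (p : x ∈ zs) → y ∈ zs → y ≢ x → y ∈ (zs ─ p)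
    ∈-─ (here refl) (here refl) y≢x = ⊥-elim (y≢x refl)
    ∈-─ (here _)    (there q)   _   = q
    ∈-─ (there _)   (here refl) _   = here refl
    ∈-─ (there p)   (there q)   y≢x = there (∈-─ p q y≢x)

    unique-⊆-length : ∀ {ys zs : List A} → Unique ys → (∀ {y} → y ∈ ys → y ∈ zs) → length ys ≤ length zs
    unique-⊆-length {[]}     _        _     = z≤n
    unique-⊆-length {y ∷ ys} {zs} (y∉ ∷ u) ys⊆zs =
      subst (suc (length ys) ≤_) (sym (length-removeAt′ zs (index y∈zs)))
        (s≤s (unique-⊆-length {zs = zs ─ y∈zs} u λ z∈ys →
          ∈-─ y∈zs (ys⊆zs (there z∈ys)) λ z≡y → All.lookup y∉ z∈ys (sym z≡y)))
      where
      y∈zs : y ∈ zs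
      y∈zs = ys⊆zs (here refl)

    map-unique : ∀ {P : Pred A 0ℓ} (f : A → A) → (∀ {x y} → P x → P y → f x ≡ f y → x ≡ y) →
                 ∀ {ys} → All P ys → Unique ys → Unique (map f ys)
    map-unique f f-inj []         []       = []
    map-unique {P} f f-inj {y ∷ _} (Py ∷ Pys) (y∉ ∷ u) = distinct-images Pys y∉ ∷ map-unique f f-inj Pys u
      where
      distinct-images : ∀ {zs} → All P zs → All (y ≢_) zs → All (f y ≢_) (map f zs)
      distinct-images []         []           = []
      distinct-images (Pz ∷ Pzs) (y≢z ∷ y≢zs) = (λ e → y≢z (f-inj Py Pz e)) ∷ distinct-images Pzs y≢zs

  module _ {xs : List A} (unique : Unique xs) where

    module _ {P : Pred A 0ℓ} (P? : Decidable P) where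

      private
        distinct : Unique (filter P? xs)
        distinct = Unique.filter⁺ P? unique

      count≤1 : (∀ {x y} → P x → P y → x ≡ y) → count P? xs ≤ 1
      count≤1 P-prop with filter P? xs | all-filter P? xs | distinct
      ... | []        | _           | _        = z≤n
      ... | _ ∷ []    | _           | _        = s≤s z≤n
      ... | _ ∷ _ ∷ _ | Px ∷ Py ∷ _ | (x∉ ∷ _) = ⊥-elim (All.head x∉ (P-prop Px Py))

      count≤2 : (∀ {x y z} → P x → P y → P z → x ≢ y → x ≢ z → y ≡ z) → count P? xs ≤ 2
      count≤2 two-values with filter P? xs | all-filter P? xs | distinct
      ... | []            | _                | _ = z≤n
      ... | _ ∷ []        | _                | _ = s≤s z≤n
      ... | _ ∷ _ ∷ []    | _                | _ = s≤s (s≤s z≤n)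
      ... | _ ∷ _ ∷ _ ∷ _ | Px ∷ Py ∷ Pz ∷ _ | (x∉ ∷ y∉ ∷ _) =
        ⊥-elim (All.head y∉ (two-values Px Py Pz (All.head x∉) (All.head (All.tail x∉))))

      count≡2-witnesses : count P? xs ≡ 2 → ∃₂ λ x y → P x × P y × x ≢ y
      count≡2-witnesses count≡2 with filter P? xs | all-filter P? xs | distinct
      ... | _ ∷ _ ∷ [] | Px ∷ Py ∷ _ | (x∉ ∷ _) = _ , _ , Px , Py , All.head x∉

    module _ (complete : ∀ x → x ∈ xs) where

      rank : A → ℕ
      rank x = toℕ (index (complete x))

      rank-injective : ∀ {x y} → rank x ≡ rank y → x ≡ y
      rank-injective {x} {y} eq = begin
        x                              ≡⟨ lookup-index (complete x) ⟩
        lookup xs (index (complete x)) ≡⟨ cong (lookup xs) (toℕ-injective eq) ⟩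
        lookup xs (index (complete y)) ≡⟨ lookup-index (complete y) ⟨
        y                              ∎
        where open ≡-Reasoning

      count≡1 : ∀ {P : Pred A 0ℓ} (P? : Decidable P) {c} → P c → (∀ {x y} → P x → P y → x ≡ y) → count P? xs ≡ 1
      count≡1 P? {c} Pc P-prop = ℕ.≤-antisym (count≤1 P? P-prop) (∈-length (∈-filter⁺ P? (complete c) Pc))

      count-≤-injection : ∀ {P Q : Pred A 0ℓ} (P? : Decidable P) (Q? : Decidable Q) (f : A → A) →
        (∀ {x} → P x → Q (f x)) → (∀ {x y} → P x → P y → f x ≡ f y → x ≡ y) →
        count P? xs ≤ count Q? xs
      count-≤-injection P? Q? f P⇒Qf f-inj =
        subst (_≤ count Q? xs) (length-map f (filter P? xs))
          (unique-⊆-length (map-unique f f-inj (all-filter P? xs) (Unique.filter⁺ P? unique)) image⊆)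
        where
        image⊆ : ∀ {y} → y ∈ map f (filter P? xs) → y ∈ filter Q? xs
        image⊆ y∈ with ∈-map⁻ f y∈
        ... | x , x∈ , refl = ∈-filter⁺ Q? (complete (f x)) (P⇒Qf (proj₂ (∈-filter⁻ P? {xs = xs} x∈)))

      -- Each orbit {x, σ x} of the involution is counted once, at its element of smaller rank.
      count-involution : ∀ {P : Pred A 0ℓ} (P? : Decidable P) (σ : A → A) →
        (∀ {x} → P x → P (σ x)) → (∀ x → σ (σ x) ≡ x) → (∀ {x} → P x → σ x ≢ x) →
        let half = count (P? ∩? λ x → rank x <? rank (σ x)) xs in
        count P? xs ≡ half ℕ.+ half
      count-involution {P} P? σ P-σ σ-involutive σ-fixpoint-free =
        trans (count-split P? Q? xs) (cong (count (P? ∩? Q?) xs ℕ.+_)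
          (ℕ.≤-antisym (count-≤-injection (P? ∩? ∁? Q?) (P? ∩? Q?) σ below (λ _ _ → σ-injective))
                       (count-≤-injection (P? ∩? Q?) (P? ∩? ∁? Q?) σ above (λ _ _ → σ-injective))))
        where
        Q? : Decidable (λ x → rank x < rank (σ x))
        Q? x = rank x <? rank (σ x)
        rank-σσ : ∀ x → rank (σ (σ x)) ≡ rank x
        rank-σσ x = cong rank (σ-involutive x)
        σ-injective : ∀ {x y} → σ x ≡ σ y → x ≡ y
        σ-injective {x} {y} e = trans (sym (σ-involutive x)) (trans (cong σ e) (σ-involutive y))
        below : ∀ {x} → P x × ¬ (rank x < rank (σ x)) → P (σ x) × rank (σ x) < rank (σ (σ x))
        below {x} (Px , not-lt) = P-σ Px , subst (rank (σ x) <_) (sym (rank-σσ x))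
          (ℕ.≤∧≢⇒< (ℕ.≮⇒≥ not-lt) λ e → σ-fixpoint-free Px (rank-injective e))
        above : ∀ {x} → P x × rank x < rank (σ x) → P (σ x) × ¬ (rank (σ x) < rank (σ (σ x)))
        above {x} (Px , lt) = P-σ Px , λ lt′ → ℕ.<-asym lt (subst (rank (σ x) <_) (rank-σσ x) lt′)

module SolutionCount where

  private
    +-tight : ∀ {m n a b} → m ≤ a → n ≤ b → m ℕ.+ n ≡ a ℕ.+ b → m ≡ a × n ≡ b
    +-tight {m} {n} {a} {b} m≤a n≤b m+n≡a+b = m≡a , ℕ.+-cancelˡ-≡ a n b (subst (λ k → k ℕ.+ n ≡ a ℕ.+ b) m≡a m+n≡a+b)
      where
      m≡a : m ≡ a
      m≡a = ℕ.≤-antisym m≤a (ℕ.+-cancelʳ-≤ b a m (subst (_≤ m ℕ.+ b) m+n≡a+b (ℕ.+-monoʳ-≤ m n≤b)))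

    ones-tight : ∀ {a b} → a ≤ 1 → b ≤ 1 → a ℕ.+ b ≡ 2 → a ≡ 1 × b ≡ 1
    ones-tight (s≤s z≤n) (s≤s z≤n) _ = refl , refl
    ones-tight z≤n       z≤n       ()
    ones-tight z≤n       (s≤s z≤n) ()
    ones-tight (s≤s z≤n) z≤n       ()

    twos-bound : ∀ {a b} → a ≤ 2 → b ≤ 2 → ¬ (a ≡ 2 × b ≡ 2) → a ℕ.+ b ≤ 3
    twos-bound {a} {b} a≤2 b≤2 ¬2,2 with ℕ.m≤n⇒m<n∨m≡n b≤2
    ... | inj₁ b<2 = ℕ.+-mono-≤ a≤2 (ℕ.≤-pred b<2)
    ... | inj₂ refl with ℕ.m≤n⇒m<n∨m≡n a≤2
    ...   | inj₁ a<2 = ℕ.+-mono-≤ (ℕ.≤-pred a<2) (ℕ.≤-refl {2})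
    ...   | inj₂ refl = ⊥-elim (¬2,2 (refl , refl))

    twos-tight : ∀ {a b} → a ≤ 2 → b ≤ 2 → a ℕ.+ b ≡ 3 → a ≡ 2 × b ≡ 1 ⊎ a ≡ 1 × b ≡ 2
    twos-tight (s≤s (s≤s z≤n)) (s≤s z≤n)       _ = inj₁ (refl , refl)
    twos-tight (s≤s z≤n)       (s≤s (s≤s z≤n)) _ = inj₂ (refl , refl)
    twos-tight z≤n             z≤n             ()
    twos-tight z≤n             (s≤s z≤n)       ()
    twos-tight z≤n             (s≤s (s≤s z≤n)) ()
    twos-tight (s≤s z≤n)       z≤n             ()
    twos-tight (s≤s z≤n)       (s≤s z≤n)       ()
    twos-tight (s≤s (s≤s z≤n)) z≤n             ()
    twos-tight (s≤s (s≤s z≤n)) (s≤s (s≤s z≤n)) ()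

  generic-bound : ∀ {a₀₀ a₁₁ a₀₁ a₁₀} → a₀₀ ≤ 1 → a₁₁ ≤ 1 → a₀₁ ≤ 2 → a₁₀ ≤ 2 →
    (a₀₁ ≡ 2 → a₁₀ ≡ 2 → a₀₀ ℕ.+ a₁₁ ≡ 0) →
    (a₀₀ ℕ.+ a₁₁) ℕ.+ (a₀₁ ℕ.+ a₁₀) ≤ 5 ×
    ((a₀₀ ℕ.+ a₁₁) ℕ.+ (a₀₁ ℕ.+ a₁₀) ≡ 5 → a₀₀ ≡ 1 × a₁₁ ≡ 1 × (a₀₁ ≡ 2 × a₁₀ ≡ 1 ⊎ a₀₁ ≡ 1 × a₁₀ ≡ 2))
  generic-bound {a₀₀} {a₁₁} {a₀₁} {a₁₀} a₀₀≤1 a₁₁≤1 a₀₁≤2 a₁₀≤2 full⇒empty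
    with (a₀₁ ℕ.≟ 2) ×-dec (a₁₀ ℕ.≟ 2)
  ... | yes (refl , refl) rewrite full⇒empty refl refl = ℕ.n≤1+n 4 , λ ()
  ... | no ¬2,2 = ℕ.+-mono-≤ L≤2 Q≤3 , λ n≡5 →
          let L≡2 , Q≡3 = +-tight L≤2 Q≤3 n≡5
              a₀₀≡1 , a₁₁≡1 = ones-tight a₀₀≤1 a₁₁≤1 L≡2
          in a₀₀≡1 , a₁₁≡1 , twos-tight a₀₁≤2 a₁₀≤2 Q≡3
    where
    L≤2 : a₀₀ ℕ.+ a₁₁ ≤ 2
    L≤2 = ℕ.+-mono-≤ a₀₀≤1 a₁₁≤1
    Q≤3 : a₀₁ ℕ.+ a₁₀ ≤ 3
    Q≤3 = twos-bound a₀₁≤2 a₁₀≤2 ¬2,2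

  exceptional-bound : ∀ {a c d} → a ≤ 1 → c ≤ 2 → d ≤ 1 → (1 ≤ a → d ≡ 0) → a ℕ.+ (c ℕ.+ d) ≤ 3
  exceptional-bound z≤n       c≤2 d≤1 _      = ℕ.+-mono-≤ c≤2 d≤1
  exceptional-bound {c = c} (s≤s z≤n) c≤2 _ a⇒d≡0 rewrite a⇒d≡0 (s≤s z≤n) | ℕ.+-identityʳ c = s≤s c≤2

  private
    ≤4 : ∀ {n} {A : Set} → n ≤ 4 → n ≤ 5 × (n ≡ 5 → A)
    ≤4 n≤4 = ℕ.m≤n⇒m≤1+n n≤4 , λ n≡5 → ⊥-elim (ℕ.<-irrefl refl (subst (_≤ 4) n≡5 n≤4))

  -- e₀ and e₁ count the solutions x = 0 and x = -1 of D x = b, and aᵢⱼ those in the class Cᵢⱼ.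
  solution-count : ∀ {e₀ e₁ a₀₀ a₁₁ a₀₁ a₁₀} →
    e₀ ≤ 1 → e₁ ≤ 1 → a₀₀ ≤ 1 → a₁₁ ≤ 1 → a₀₁ ≤ 2 → a₁₀ ≤ 2 →
    (1 ≤ e₀ → 1 ≤ e₁ → ⊥) →
    (1 ≤ e₀ → a₀₀ ≡ 0 × a₁₀ ≤ 1 × (1 ≤ a₁₁ → a₁₀ ≡ 0)) →
    (1 ≤ e₁ → a₁₁ ≡ 0 × a₁₀ ≤ 1 × (1 ≤ a₀₀ → a₁₀ ≡ 0)) →
    (a₀₁ ≡ 2 → a₁₀ ≡ 2 → a₀₀ ℕ.+ a₁₁ ≡ 0) →
    let n = e₀ ℕ.+ (e₁ ℕ.+ ((a₀₀ ℕ.+ a₁₁) ℕ.+ (a₀₁ ℕ.+ a₁₀))) in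
    n ≤ 5 × (n ≡ 5 → a₀₀ ≡ 1 × a₁₁ ≡ 1 × (a₀₁ ≡ 2 × a₁₀ ≡ 1 ⊎ a₀₁ ≡ 1 × a₁₀ ≡ 2))
  solution-count (s≤s z≤n) (s≤s z≤n) _ _ _ _ not-both _ _ _ = ⊥-elim (not-both (s≤s z≤n) (s≤s z≤n))
  solution-count (s≤s z≤n) z≤n _ a₁₁≤1 a₀₁≤2 _ _ at-0 _ _ with at-0 (s≤s z≤n)
  ... | refl , a₁₀≤1 , a₁₁⇒a₁₀≡0 = ≤4 (s≤s (exceptional-bound a₁₁≤1 a₀₁≤2 a₁₀≤1 a₁₁⇒a₁₀≡0))
  solution-count {a₀₀ = a₀₀} z≤n (s≤s z≤n) a₀₀≤1 _ a₀₁≤2 _ _ _ at-1 _ with at-1 (s≤s z≤n)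
  ... | refl , a₁₀≤1 , a₀₀⇒a₁₀≡0 rewrite ℕ.+-identityʳ a₀₀ =
    ≤4 (s≤s (exceptional-bound a₀₀≤1 a₀₁≤2 a₁₀≤1 a₀₀⇒a₁₀≡0))
  solution-count z≤n z≤n a₀₀≤1 a₁₁≤1 a₀₁≤2 a₁₀≤2 _ _ _ full⇒empty = generic-bound a₀₀≤1 a₁₁≤1 a₀₁≤2 a₁₀≤2 full⇒empty

module FieldFacts (K : FiniteField) where

  open FiniteField K

  commutativeRing : CommutativeRing 0ℓ 0ℓ
  commutativeRing = record { isCommutativeRing = isCommutativeRing }

  open CommutativeRing commutativeRing public
    using (+-comm; +-identityˡ; +-identityʳ; -‿inverseˡ; -‿inverseʳ; *-assoc; *-comm; *-identityˡ; zeroˡ; zeroʳ)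
  open import Algebra.Properties.Ring (CommutativeRing.ring commutativeRing) public
    using (-‿involutive; -‿injective; -0#≈0#; +-inverseʳ-unique; +-cancelʳ)
  open IntegerCoefficients commutativeRing public
    using (ι; solve; _:+_; _:*_; :-_; _:-_; _:=_; con)

  2# : Carrier
  2# = 1# + 1#

  #_ : {P : Pred Carrier 0ℓ} → Decidable P → ℕ
  # P? = Counting.count P? elems

  position : Carrier → ℕ
  position = Counting.rank elems-unique elems-complete

  xy≡0⇒y≡0 : ∀ {x y} → x ≢ 0# → x * y ≡ 0# → y ≡ 0#
  xy≡0⇒y≡0 {x} {y} x≢0 xy≡0 with inverse x x≢0
  ... | x⁻¹ , xx⁻¹≡1 = begin
    y                                  ≡⟨ solve 3 (λ x x⁻¹ y → y := y :+ x⁻¹ :* (x :* y) :- y :* (x :* x⁻¹)) refl x x⁻¹ y ⟩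
    y + x⁻¹ * (x * y) - y * (x * x⁻¹)  ≡⟨ cong₂ (λ a b → y + x⁻¹ * a - y * b) xy≡0 xx⁻¹≡1 ⟩
    y + x⁻¹ * 0# - y * 1#              ≡⟨ solve 2 (λ x⁻¹ y → y :+ x⁻¹ :* con 0ℤ :- y :* con 1ℤ := con 0ℤ) refl x⁻¹ y ⟩
    0#                                 ∎
    where open ≡-Reasoning

  x*y≡0⇒x≡0∨y≡0 : ∀ {x y} → x * y ≡ 0# → x ≡ 0# ⊎ y ≡ 0#
  x*y≡0⇒x≡0∨y≡0 {x} xy≡0 with x ≟ 0#
  ... | yes x≡0 = inj₁ x≡0
  ... | no x≢0  = inj₂ (xy≡0⇒y≡0 x≢0 xy≡0)

  x*y≢0 : ∀ {x y} → x ≢ 0# → y ≢ 0# → x * y ≢ 0#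
  x*y≢0 x≢0 y≢0 xy≡0 = y≢0 (xy≡0⇒y≡0 x≢0 xy≡0)

  x-y≡0⇒x≡y : ∀ {x y} → x - y ≡ 0# → x ≡ y
  x-y≡0⇒x≡y {x} {y} x-y≡0 = -‿injective (sym (+-inverseʳ-unique x (- y) x-y≡0))

  x≡y⇒x-y≡0 : ∀ {x y} → x ≡ y → x - y ≡ 0#
  x≡y⇒x-y≡0 {x} refl = -‿inverseʳ x

  *-cancelˡ : ∀ {x y z} → x ≢ 0# → x * y ≡ x * z → y ≡ z
  *-cancelˡ {x} {y} {z} x≢0 xy≡xz = x-y≡0⇒x≡y (xy≡0⇒y≡0 x≢0
    (trans (solve 3 (λ x y z → x :* (y :- z) := x :* y :- x :* z) refl x y z) (x≡y⇒x-y≡0 xy≡xz)))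

  -x≢0 : ∀ {x} → x ≢ 0# → - x ≢ 0#
  -x≢0 {x} x≢0 -x≡0 = x≢0 (trans (sym (-‿involutive x)) (trans (cong -_ -x≡0) -0#≈0#))

  1≢0 : 1# ≢ 0#
  1≢0 1≡0 = 0≢1 (sym 1≡0)

  1ℤ≢-1ℤ : 1ℤ ≢ -1ℤ
  1ℤ≢-1ℤ ()

  quadratic : Carrier → Carrier → Carrier → Carrier → Carrier
  quadratic α β γ x = α * (x * x) + β * x + γ

  -- No hypothesis on α: two distinct points with the same value force α (x + y) + β = 0.
  quadratic-factorisation : ∀ {α β γ b x y} → x ≢ y →
    quadratic α β γ x ≡ b → quadratic α β γ y ≡ b →
    ∀ z → quadratic α β γ z - b ≡ α * ((z - x) * (z - y))
  quadratic-factorisation {α} {β} {γ} {b} {x} {y} x≢y qx≡b qy≡b z = begin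
    q z - b                                          ≡⟨ cong (λ t → q z - t) qx≡b ⟨
    q z - q x                                        ≡⟨ solve 6 (λ α β γ z x y →
      (α :* (z :* z) :+ β :* z :+ γ) :- (α :* (x :* x) :+ β :* x :+ γ)
        := α :* ((z :- x) :* (z :- y)) :+ (z :- x) :* (α :* (x :+ y) :+ β)) refl α β γ z x y ⟩
    α * ((z - x) * (z - y)) + (z - x) * vieta        ≡⟨ cong (λ t → α * ((z - x) * (z - y)) + (z - x) * t) vieta≡0 ⟩
    α * ((z - x) * (z - y)) + (z - x) * 0#           ≡⟨ cong (λ t → α * ((z - x) * (z - y)) + t) (zeroʳ (z - x)) ⟩
    α * ((z - x) * (z - y)) + 0#                     ≡⟨ +-identityʳ _ ⟩
    α * ((z - x) * (z - y))                          ∎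
    where
    open ≡-Reasoning
    q : Carrier → Carrier
    q = quadratic α β γ
    vieta : Carrier
    vieta = α * (x + y) + β
    vieta≡0 : vieta ≡ 0#
    vieta≡0 = xy≡0⇒y≡0 (λ x-y≡0 → x≢y (x-y≡0⇒x≡y x-y≡0)) (trans (solve 5 (λ α β γ x y →
        (x :- y) :* (α :* (x :+ y) :+ β) := (α :* (x :* x) :+ β :* x :+ γ) :- (α :* (y :* y) :+ β :* y :+ γ)) refl α β γ x y)
        (x≡y⇒x-y≡0 (trans qx≡b (sym qy≡b))))

  quadratic-two-roots : ∀ {α β γ b x y z} → α ≢ 0# → x ≢ y → x ≢ z →
    quadratic α β γ x ≡ b → quadratic α β γ y ≡ b → quadratic α β γ z ≡ b → y ≡ z
  quadratic-two-roots {z = z} α≢0 x≢y x≢z qx≡b qy≡b qz≡b = sym (x-y≡0⇒x≡y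
    (xy≡0⇒y≡0 (λ z-x≡0 → x≢z (sym (x-y≡0⇒x≡y z-x≡0)))
      (xy≡0⇒y≡0 α≢0 (trans (sym (quadratic-factorisation x≢y qx≡b qy≡b z)) (x≡y⇒x-y≡0 qz≡b)))))

  IsSquare : Carrier → Set
  IsSquare x = ∃ λ y → y * y ≡ x

  square-* : ∀ {x y} → IsSquare x → IsSquare y → IsSquare (x * y)
  square-* (a , refl) (b , refl) = a * b , solve 2 (λ a b → (a :* b) :* (a :* b) := (a :* a) :* (b :* b)) refl a b

  square-cancelˡ : ∀ {x y} → x ≢ 0# → IsSquare x → IsSquare (x * y) → IsSquare y
  square-cancelˡ {y = y} x≢0 (a , refl) (c , c²≡a²y) with inverse a (λ a≡0 → x≢0 (trans (cong (_* a) a≡0) (zeroˡ a)))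
  ... | a⁻¹ , aa⁻¹≡1 = c * a⁻¹ , (begin
    (c * a⁻¹) * (c * a⁻¹)              ≡⟨ solve 2 (λ c a⁻¹ → (c :* a⁻¹) :* (c :* a⁻¹) := (c :* c) :* (a⁻¹ :* a⁻¹)) refl c a⁻¹ ⟩
    (c * c) * (a⁻¹ * a⁻¹)              ≡⟨ cong (_* (a⁻¹ * a⁻¹)) c²≡a²y ⟩
    ((a * a) * y) * (a⁻¹ * a⁻¹)
      ≡⟨ solve 3 (λ a a⁻¹ y → ((a :* a) :* y) :* (a⁻¹ :* a⁻¹) := ((a :* a⁻¹) :* (a :* a⁻¹)) :* y) refl a a⁻¹ y ⟩
    ((a * a⁻¹) * (a * a⁻¹)) * y        ≡⟨ cong (λ e → (e * e) * y) aa⁻¹≡1 ⟩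
    (1# * 1#) * y                      ≡⟨ solve 1 (λ y → (con 1ℤ :* con 1ℤ) :* y := y) refl y ⟩
    y                                  ∎)
    where open ≡-Reasoning

  data Character (x : Carrier) : ℤ → Set where
    at-zero      : x ≡ 0# → Character x 0ℤ
    at-square    : x ≢ 0# → IsSquare x → Character x 1ℤ
    at-nonsquare : x ≢ 0# → ¬ IsSquare x → Character x -1ℤ

  character : ∀ x → Character x (η K x)
  character x with x ≟ 0#
  ... | yes x≡0 = at-zero x≡0
  ... | no x≢0 with any? (λ y → (y * y) ≟ x) elems
  ...   | yes ∃root = at-square x≢0 (satisfied ∃root)
  ...   | no ∄root  = at-nonsquare x≢0 λ (y , y²≡x) → ∄root (lose (elems-complete y) y²≡x)

  η-zero : η K 0# ≡ 0ℤ
  η-zero with η K 0# | character 0#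
  ... | _ | at-zero _        = refl
  ... | _ | at-square 0≢0 _    = ⊥-elim (0≢0 refl)
  ... | _ | at-nonsquare 0≢0 _ = ⊥-elim (0≢0 refl)

  η-square : ∀ {x} → x ≢ 0# → IsSquare x → η K x ≡ 1ℤ
  η-square {x} x≢0 sq with η K x | character x
  ... | _ | at-zero x≡0        = ⊥-elim (x≢0 x≡0)
  ... | _ | at-square _ _      = refl
  ... | _ | at-nonsquare _ ¬sq = ⊥-elim (¬sq sq)

  η-nonsquare : ∀ {x} → x ≢ 0# → ¬ IsSquare x → η K x ≡ -1ℤ
  η-nonsquare {x} x≢0 ¬sq with η K x | character x
  ... | _ | at-zero x≡0      = ⊥-elim (x≢0 x≡0)
  ... | _ | at-square _ sq   = ⊥-elim (¬sq sq)
  ... | _ | at-nonsquare _ _ = refl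

  character-of : ∀ {x v} → η K x ≡ v → Character x v
  character-of {x} refl = character x

  η≡1⇒square : ∀ {x} → η K x ≡ 1ℤ → IsSquare x
  η≡1⇒square η≡1 with character-of η≡1
  ... | at-square _ sq = sq

  η≡-1⇒nonsquare : ∀ {x} → η K x ≡ -1ℤ → ¬ IsSquare x
  η≡-1⇒nonsquare η≡-1 with character-of η≡-1
  ... | at-nonsquare _ ¬sq = ¬sq

  η≡±1⇒≢0 : ∀ {x} i → η K x ≡ sgn K i → x ≢ 0#
  η≡±1⇒≢0 zero    η≡1  with character-of η≡1
  ... | at-square x≢0 _ = x≢0
  η≡±1⇒≢0 (suc _) η≡-1 with character-of η≡-1
  ... | at-nonsquare x≢0 _ = x≢0

  η≢1⇒≡-1 : ∀ {x} → x ≢ 0# → η K x ≢ 1ℤ → η K x ≡ -1ℤ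
  η≢1⇒≡-1 {x} x≢0 η≢1 with η K x | character x
  ... | _ | at-zero x≡0      = ⊥-elim (x≢0 x≡0)
  ... | _ | at-square _ _    = ⊥-elim (η≢1 refl)
  ... | _ | at-nonsquare _ _ = refl

  η-≢0 : ∀ {x} → x ≢ 0# → η K x ≡ 1ℤ ⊎ η K x ≡ -1ℤ
  η-≢0 {x} x≢0 with η K x | character x
  ... | _ | at-zero x≡0      = ⊥-elim (x≢0 x≡0)
  ... | _ | at-square _ _    = inj₁ refl
  ... | _ | at-nonsquare _ _ = inj₂ refl

  ηF≡ι∘η : ∀ x → ηF K x ≡ ι (η K x)
  ηF≡ι∘η x with η K x | character x
  ... | _ | at-zero _        = refl
  ... | _ | at-square _ _    = refl
  ... | _ | at-nonsquare _ _ = refl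

  x+1≡0⇒x≡-1 : ∀ {x} → x + 1# ≡ 0# → x ≡ - 1#
  x+1≡0⇒x≡-1 {x} x+1≡0 = +-inverseʳ-unique 1# x (trans (+-comm 1# x) x+1≡0)

  η-cancelˡ : ∀ {a i j} → a ≢ 0# → η K a ℤ.* i ≡ η K a ℤ.* j → i ≡ j
  η-cancelˡ {a} {i} {j} a≢0 eq with η-≢0 a≢0
  ... | inj₁ ηa≡1  = ℤ.*-cancelˡ-≡ 1ℤ i j (subst (λ s → s ℤ.* i ≡ s ℤ.* j) ηa≡1 eq)
  ... | inj₂ ηa≡-1 = ℤ.*-cancelˡ-≡ -1ℤ i j (subst (λ s → s ℤ.* i ≡ s ℤ.* j) ηa≡-1 eq)

  η≢-η : ∀ {a} → a ≢ 0# → η K a ≢ ℤ.- η K a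
  η≢-η a≢0 eq with η-≢0 a≢0
  ... | inj₁ ηa≡1  = 1ℤ≢-1ℤ (trans (sym ηa≡1) (trans eq (cong ℤ.-_ ηa≡1)))
  ... | inj₂ ηa≡-1 = 1ℤ≢-1ℤ (sym (trans (sym ηa≡-1) (trans eq (cong ℤ.-_ ηa≡-1))))

  η1≡1 : η K 1# ≡ 1ℤ
  η1≡1 = η-square 1≢0 (1# , *-identityˡ 1#)

module Multiplicativity (K : FiniteField) (2≢0 : FieldFacts.2# K ≢ FiniteField.0# K) where

  open FiniteField K
  open FieldFacts K
  open Counting

  -x≢x : ∀ {x} → x ≢ 0# → - x ≢ x
  -x≢x {x} x≢0 -x≡x = x*y≢0 2≢0 x≢0 (begin
    2# * x   ≡⟨ solve 1 (λ x → con (ℤ.+ 2) :* x := x :+ x) refl x ⟩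
    x + x    ≡⟨ cong (x +_) -x≡x ⟨
    x + - x  ≡⟨ -‿inverseʳ x ⟩
    0#       ∎)
    where open ≡-Reasoning

  square-roots : ∀ {x y} → x * x ≡ y * y → x ≡ y ⊎ x ≡ - y
  square-roots {x} {y} x²≡y² = Sum.map x-y≡0⇒x≡y (+-inverseʳ-unique y x) (x*y≡0⇒x≡0∨y≡0
    (trans (solve 2 (λ x y → (x :- y) :* (y :+ x) := x :* x :- y :* y) refl x y) (x≡y⇒x-y≡0 x²≡y²)))

  NonZero? : Decidable (_≢ 0#)
  NonZero? x = ¬? (x ≟ 0#)

  Square? : Decidable (λ x → η K x ≡ 1ℤ)
  Square? x = η K x ℤ.≟ 1ℤ

  Nonsquare? : Decidable (λ x → η K x ≡ -1ℤ)
  Nonsquare? x = η K x ℤ.≟ -1ℤ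

  Half : Pred Carrier 0ℓ
  Half x = x ≢ 0# × position x < position (- x)

  Half? : Decidable Half
  Half? = NonZero? ∩? λ x → position x <? position (- x)

  #nonzero≡#half+#half : # NonZero? ≡ # Half? ℕ.+ # Half?
  #nonzero≡#half+#half = count-involution elems-unique elems-complete NonZero? -_ -x≢0 -‿involutive -x≢x

  private
    position-- : ∀ x → position (- - x) ≡ position x
    position-- x = cong position (-‿involutive x)

    half-squaring-injective : ∀ {x y} → Half x → Half y → x * x ≡ y * y → x ≡ y
    half-squaring-injective {x} {y} (_ , x<-x) (_ , y<-y) x²≡y² = choose (square-roots x²≡y²)
      where
      choose : x ≡ y ⊎ x ≡ - y → x ≡ y
      choose (inj₁ x≡y)  = x≡y
      choose (inj₂ x≡-y) = ⊥-elim (ℕ.<-asym y<-y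
        (subst (position (- y) <_) (position-- y) (subst (λ w → position w < position (- w)) x≡-y x<-x)))

  #half≤#squares : # Half? ≤ # Square?
  #half≤#squares = count-≤-injection elems-unique elems-complete Half? Square? (λ x → x * x)
    (λ (x≢0 , _) → η-square (x*y≢0 x≢0 x≢0) (_ , refl)) half-squaring-injective

  -- The square root lying in Half (a junk value when s is not a nonzero square).
  root : Carrier → Carrier
  root s with any? (λ y → ((y * y) ≟ s) ×-dec Half? y) elems
  ... | yes ∃y = proj₁ (satisfied ∃y)
  ... | no _   = s

  root-spec : ∀ {s} → η K s ≡ 1ℤ → root s * root s ≡ s × Half (root s)
  root-spec {s} η≡1 with any? (λ y → ((y * y) ≟ s) ×-dec Half? y) elems
  ... | yes ∃y = proj₂ (satisfied ∃y)
  ... | no ∄y with η≡1⇒square η≡1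
  ...   | y , y²≡s with position y <? position (- y)
  ...     | yes y<-y = ⊥-elim (∄y (lose (elems-complete y) (y²≡s , y≢0 , y<-y)))
    where
    y≢0 : y ≢ 0#
    y≢0 refl = η≡±1⇒≢0 0 η≡1 (trans (sym y²≡s) (zeroˡ 0#))
  ...     | no y≮-y = ⊥-elim (∄y (lose (elems-complete (- y)) (-y²≡s , -x≢0 y≢0 , -y<y)))
    where
    y≢0 : y ≢ 0#
    y≢0 refl = η≡±1⇒≢0 0 η≡1 (trans (sym y²≡s) (zeroˡ 0#))
    -y²≡s : (- y) * (- y) ≡ s
    -y²≡s = trans (solve 1 (λ y → (:- y) :* (:- y) := y :* y) refl y) y²≡s
    -y<y : position (- y) < position (- - y)
    -y<y = subst (position (- y) <_) (sym (position-- y))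
      (ℕ.≤∧≢⇒< (ℕ.≮⇒≥ y≮-y) λ e → -x≢x y≢0 (rank-injective elems-unique elems-complete e))

  #squares≤#half : # Square? ≤ # Half?
  #squares≤#half = count-≤-injection elems-unique elems-complete Square? Half? root
    (λ η≡1 → proj₂ (root-spec η≡1))
    (λ {x} {y} ηx ηy rx≡ry → trans (sym (proj₁ (root-spec ηx)))
      (trans (cong (λ r → r * r) rx≡ry) (proj₁ (root-spec ηy))))

  #nonzero≡#squares+#nonsquares : # NonZero? ≡ # Square? ℕ.+ # Nonsquare?
  #nonzero≡#squares+#nonsquares = trans (count-split NonZero? Square? elems) (cong₂ ℕ._+_
    (count-cong (NonZero? ∩? Square?) Square? (proj₂ , λ η≡1 → (η≡±1⇒≢0 0 η≡1 , η≡1)) elems)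
    (count-cong (NonZero? ∩? ∁? Square?) Nonsquare? ((λ (x≢0 , η≢1) → η≢1⇒≡-1 x≢0 η≢1) ,
       λ η≡-1 → (η≡±1⇒≢0 1 η≡-1 , λ η≡1 → 1ℤ≢-1ℤ (trans (sym η≡1) η≡-1))) elems))

  #squares≡#nonsquares : # Square? ≡ # Nonsquare?
  #squares≡#nonsquares = ℕ.+-cancelˡ-≡ (# Square?) _ _ (begin
    # Square? ℕ.+ # Square?         ≡⟨ cong₂ ℕ._+_ #squares≡#half #squares≡#half ⟩
    # Half? ℕ.+ # Half?             ≡⟨ #nonzero≡#half+#half ⟨
    # NonZero?                      ≡⟨ #nonzero≡#squares+#nonsquares ⟩
    # Square? ℕ.+ # Nonsquare?      ∎)
    where
    open ≡-Reasoning
    #squares≡#half : # Square? ≡ # Half?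
    #squares≡#half = ℕ.≤-antisym #squares≤#half #half≤#squares

  nonsquare*nonsquare : ∀ {n m} → η K n ≡ -1ℤ → η K m ≡ -1ℤ → IsSquare (n * m)
  nonsquare*nonsquare {n} {m} ηn ηm with any? (λ s → Square? s ×-dec ((n * s) ≟ m)) elems
  ... | yes ∃s with satisfied ∃s
  ...   | s , ηs , refl = subst IsSquare (*-assoc n n s) (square-* (n , refl) (η≡1⇒square ηs))
  nonsquare*nonsquare {n} {m} ηn ηm | no ∄s = ⊥-elim (ℕ.<-irrefl refl (begin-strict
    # Square?
      ≤⟨ count-≤-injection elems-unique elems-complete Square? Nonsquare∖m? (n *_) n*-into (λ _ _ → *-cancelˡ n≢0) ⟩
    # Nonsquare∖m?                 <⟨ ℕ.n<1+n _ ⟩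
    1 ℕ.+ # Nonsquare∖m?           ≡⟨ cong (ℕ._+ # Nonsquare∖m?) #m ⟨
    # (Nonsquare? ∩? (_≟ m)) ℕ.+ # Nonsquare∖m?  ≡⟨ count-split Nonsquare? (_≟ m) elems ⟨
    # Nonsquare?                   ≡⟨ #squares≡#nonsquares ⟨
    # Square?                      ∎))
    where
    open ℕ.≤-Reasoning
    Nonsquare∖m? : Decidable (λ x → η K x ≡ -1ℤ × x ≢ m)
    Nonsquare∖m? = Nonsquare? ∩? ∁? (_≟ m)
    n≢0 : n ≢ 0#
    n≢0 = η≡±1⇒≢0 1 ηn
    #m : # (Nonsquare? ∩? (_≟ m)) ≡ 1
    #m = count≡1 elems-unique elems-complete (Nonsquare? ∩? (_≟ m)) (ηm , refl) λ (_ , x≡m) (_ , y≡m) → trans x≡m (sym y≡m)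
    n*-into : ∀ {s} → η K s ≡ 1ℤ → η K (n * s) ≡ -1ℤ × n * s ≢ m
    n*-into {s} ηs = η-nonsquare (x*y≢0 n≢0 s≢0) (λ sq → η≡-1⇒nonsquare ηn
                       (square-cancelˡ s≢0 (η≡1⇒square ηs) (subst IsSquare (*-comm n s) sq)))
                   , λ ns≡m → ∄s (lose (elems-complete s) (ηs , ns≡m))
      where
      s≢0 : s ≢ 0#
      s≢0 = η≡±1⇒≢0 0 ηs

  η-* : ∀ x y → η K (x * y) ≡ η K x ℤ.* η K y
  η-* x y with η K x | character x | η K y | character y
  ... | _ | at-zero refl        | _ | _                    = trans (cong (η K) (zeroˡ y)) η-zero
  ... | _ | at-square _ _       | _ | at-zero refl         = trans (cong (η K) (zeroʳ x)) η-zero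
  ... | _ | at-nonsquare _ _    | _ | at-zero refl         = trans (cong (η K) (zeroʳ x)) η-zero
  ... | _ | at-square x≢0 x-sq  | _ | at-square y≢0 y-sq  = η-square (x*y≢0 x≢0 y≢0) (square-* x-sq y-sq)
  ... | _ | at-square x≢0 x-sq  | _ | at-nonsquare y≢0 ¬y-sq =
    η-nonsquare (x*y≢0 x≢0 y≢0) λ sq → ¬y-sq (square-cancelˡ x≢0 x-sq sq)
  ... | _ | at-nonsquare x≢0 ¬x-sq | _ | at-square y≢0 y-sq =
    η-nonsquare (x*y≢0 x≢0 y≢0) λ sq → ¬x-sq (square-cancelˡ y≢0 y-sq (subst IsSquare (*-comm x y) sq))
  ... | _ | at-nonsquare x≢0 ¬x-sq | _ | at-nonsquare y≢0 ¬y-sq =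
    η-square (x*y≢0 x≢0 y≢0) (nonsquare*nonsquare (η-nonsquare x≢0 ¬x-sq) (η-nonsquare y≢0 ¬y-sq))

module ThreeModFour (K : FiniteField) (card%4≡3 : FiniteField.card K % 4 ≡ 3) where

  open FiniteField K
  open FieldFacts K
  open Counting

  private
    card%2≡1 : card % 2 ≡ 1
    card%2≡1 = trans (sym (m∣n⇒o%n%m≡o%m 2 4 card (divides 2 refl))) (cong (_% 2) card%4≡3)

    card≢h+h : ∀ h → card ≢ h ℕ.+ h
    card≢h+h h card≡h+h with trans (sym card%2≡1) (trans (cong (_% 2) (trans card≡h+h (h+h≡h*2 h))) (m*n%n≡0 h 2))
      where
      h+h≡h*2 : ∀ h → h ℕ.+ h ≡ h ℕ.* 2
      h+h≡h*2 = solve-∀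
    ... | ()

    card≢1+4h : ∀ h → card ≢ 1 ℕ.+ ((h ℕ.+ h) ℕ.+ (h ℕ.+ h))
    card≢1+4h h card≡1+4h with trans (sym card%4≡3) (trans (cong (_% 4) (trans card≡1+4h (1+4h≡1+h*4 h))) ([m+kn]%n≡m%n 1 h 4))
      where
      1+4h≡1+h*4 : ∀ h → 1 ℕ.+ ((h ℕ.+ h) ℕ.+ (h ℕ.+ h)) ≡ 1 ℕ.+ h ℕ.* 4
      1+4h≡1+h*4 = solve-∀
    ... | ()

  -- In characteristic 2, x ↦ x + 1 would pair off all elements.
  2≢0 : 2# ≢ 0#
  2≢0 2≡0 = card≢h+h (# (U? ∩? λ x → position x <? position (x + 1#))) (trans (sym (count≡length U? (λ _ → tt) elems))
    (count-involution elems-unique elems-complete U? (_+ 1#) (λ _ → tt) +1+1 (λ _ x+1≡x → 1≢0 (x+1≡x⇒1≡0 x+1≡x))))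
    where
    +1+1 : ∀ x → (x + 1#) + 1# ≡ x
    +1+1 x = trans (solve 1 (λ x → (x :+ con 1ℤ) :+ con 1ℤ := x :+ con (ℤ.+ 2)) refl x)
                   (trans (cong (x +_) 2≡0) (+-identityʳ x))
    x+1≡x⇒1≡0 : ∀ {x} → x + 1# ≡ x → 1# ≡ 0#
    x+1≡x⇒1≡0 {x} x+1≡x = trans (solve 1 (λ x → con 1ℤ := (x :+ con 1ℤ) :- x) refl x) (x≡y⇒x-y≡0 x+1≡x)

  open Multiplicativity K 2≢0 public

  private
    card≡1+#nonzero : card ≡ 1 ℕ.+ # NonZero?
    card≡1+#nonzero = begin
      card                                            ≡⟨ count≡length U? (λ _ → tt) elems ⟨
      # U?                                            ≡⟨ count-split U? (_≟ 0#) elems ⟩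
      # (U? ∩? (_≟ 0#)) ℕ.+ # (U? ∩? ∁? (_≟ 0#))
        ≡⟨ cong₂ ℕ._+_ #zero (count-cong (U? ∩? ∁? (_≟ 0#)) NonZero? (proj₂ , (_ ,_)) elems) ⟩
      1 ℕ.+ # NonZero?                                ∎
      where
      open ≡-Reasoning
      #zero : # (U? ∩? (_≟ 0#)) ≡ 1
      #zero = count≡1 elems-unique elems-complete (U? ∩? (_≟ 0#)) (_ , refl) λ (_ , x≡0) (_ , y≡0) → trans x≡0 (sym y≡0)

    -x≡-1*x : ∀ x → - x ≡ (- 1#) * x
    -x≡-1*x = solve 1 (λ x → :- x := (:- con 1ℤ) :* x) refl

  -- If -1 were a square, negation would pair off the squares, making q ≡ 1 (mod 4).
  η[-1]≡-1 : η K (- 1#) ≡ -1ℤ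
  η[-1]≡-1 with η-≢0 (-x≢0 1≢0)
  ... | inj₂ η≡-1 = η≡-1
  ... | inj₁ η≡1  = ⊥-elim (card≢1+4h h (begin
    card                                          ≡⟨ card≡1+#nonzero ⟩
    1 ℕ.+ # NonZero?                               ≡⟨ cong (1 ℕ.+_) #nonzero≡#squares+#nonsquares ⟩
    1 ℕ.+ (# Square? ℕ.+ # Nonsquare?)             ≡⟨ cong (λ n → 1 ℕ.+ (# Square? ℕ.+ n)) #squares≡#nonsquares ⟨
    1 ℕ.+ (# Square? ℕ.+ # Square?)                ≡⟨ cong (λ n → 1 ℕ.+ (n ℕ.+ n)) #squares-even ⟩
    1 ℕ.+ ((h ℕ.+ h) ℕ.+ (h ℕ.+ h))                ∎))
    where
    open ≡-Reasoning
    h : ℕ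
    h = # (Square? ∩? λ x → position x <? position (- x))
    -square : ∀ {x} → η K x ≡ 1ℤ → η K (- x) ≡ 1ℤ
    -square {x} ηx = trans (cong (η K) (-x≡-1*x x)) (trans (η-* (- 1#) x) (cong₂ ℤ._*_ η≡1 ηx))
    #squares-even : # Square? ≡ h ℕ.+ h
    #squares-even = count-involution elems-unique elems-complete Square? -_ -square -‿involutive
                      (λ ηx → -x≢x (η≡±1⇒≢0 0 ηx))

  η-neg : ∀ x → η K (- x) ≡ ℤ.- η K x
  η-neg x = trans (cong (η K) (-x≡-1*x x)) (trans (η-* (- 1#) x) (trans (cong (ℤ._* η K x) η[-1]≡-1) (ℤ.-1*i≡-i (η K x))))

module DifferentialUniformity (K : FiniteField) (card%4≡3 : FiniteField.card K % 4 ≡ 3) (u : FiniteField.Carrier K)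
  (u≢0 : u ≢ FiniteField.0# K) (u≢1 : u ≢ FiniteField.1# K) (u≢-1 : u ≢ FiniteField.-_ K (FiniteField.1# K)) where

  open FiniteField K
  open FieldFacts K
  open ThreeModFour K card%4≡3
  open Counting
  open SolutionCount

  F : Carrier → Carrier
  F = F2 K u

  D : Carrier → Carrier
  D x = F (x + 1#) - F x

  u₊ u₋ : Carrier
  u₊ = 1# + u
  u₋ = 1# - u

  u₊≢0 : u₊ ≢ 0#
  u₊≢0 u₊≡0 = u≢-1 (+-inverseʳ-unique 1# u u₊≡0)

  u₋≢0 : u₋ ≢ 0#
  u₋≢0 u₋≡0 = u≢1 (sym (x-y≡0⇒x≡y u₋≡0))

  F-value : ∀ {x s} → η K x ≡ s → F x ≡ x * x * (1# + u * ι s)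
  F-value {x} ηx≡s = cong (λ t → x * x * (1# + u * t)) (trans (ηF≡ι∘η x) (cong ι ηx≡s))

  D-value : ∀ {x s t} → η K x ≡ s → η K (x + 1#) ≡ t →
    D x ≡ (x + 1#) * (x + 1#) * (1# + u * ι t) - x * x * (1# + u * ι s)
  D-value ηx ηx+1 = cong₂ _-_ (F-value ηx+1) (F-value ηx)

  D₀₀ : ∀ {x} → η K x ≡ 1ℤ → η K (x + 1#) ≡ 1ℤ → D x ≡ u₊ * (2# * x + 1#)
  D₀₀ {x} ηx ηx+1 = trans (D-value ηx ηx+1) (solve 2 (λ x u →
    (x :+ con 1ℤ) :* (x :+ con 1ℤ) :* (con 1ℤ :+ u :* con 1ℤ) :- x :* x :* (con 1ℤ :+ u :* con 1ℤ)
      := (con 1ℤ :+ u) :* (con (ℤ.+ 2) :* x :+ con 1ℤ)) refl x u)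

  D₁₁ : ∀ {x} → η K x ≡ -1ℤ → η K (x + 1#) ≡ -1ℤ → D x ≡ u₋ * (2# * x + 1#)
  D₁₁ {x} ηx ηx+1 = trans (D-value ηx ηx+1) (solve 2 (λ x u →
    (x :+ con 1ℤ) :* (x :+ con 1ℤ) :* (con 1ℤ :+ u :* con -1ℤ) :- x :* x :* (con 1ℤ :+ u :* con -1ℤ)
      := (con 1ℤ :- u) :* (con (ℤ.+ 2) :* x :+ con 1ℤ)) refl x u)

  D₀₁ : ∀ {x} → η K x ≡ 1ℤ → η K (x + 1#) ≡ -1ℤ → D x ≡ quadratic (- (2# * u)) (2# * u₋) u₋ x
  D₀₁ {x} ηx ηx+1 = trans (D-value ηx ηx+1) (solve 2 (λ x u →
    (x :+ con 1ℤ) :* (x :+ con 1ℤ) :* (con 1ℤ :+ u :* con -1ℤ) :- x :* x :* (con 1ℤ :+ u :* con 1ℤ)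
      := (:- (con (ℤ.+ 2) :* u)) :* (x :* x) :+ (con (ℤ.+ 2) :* (con 1ℤ :- u)) :* x :+ (con 1ℤ :- u)) refl x u)

  D₁₀ : ∀ {x} → η K x ≡ -1ℤ → η K (x + 1#) ≡ 1ℤ → D x ≡ quadratic (2# * u) (2# * u₊) u₊ x
  D₁₀ {x} ηx ηx+1 = trans (D-value ηx ηx+1) (solve 2 (λ x u →
    (x :+ con 1ℤ) :* (x :+ con 1ℤ) :* (con 1ℤ :+ u :* con 1ℤ) :- x :* x :* (con 1ℤ :+ u :* con -1ℤ)
      := (con (ℤ.+ 2) :* u) :* (x :* x) :+ (con (ℤ.+ 2) :* (con 1ℤ :+ u)) :* x :+ (con 1ℤ :+ u)) refl x u)

  InA : ℕ → ℕ → Carrier → Pred Carrier 0ℓ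
  InA i j b x = η K x ≡ sgn K i × η K (x + 1#) ≡ sgn K j × D x ≡ b

  A? : ∀ i j b → Decidable (InA i j b)
  A? i j b x = (η K x ℤ.≟ sgn K i) ×-dec ((η K (x + 1#) ℤ.≟ sgn K j) ×-dec (D x ≟ b))

  linear-injective : ∀ {c x y} → c ≢ 0# → c * (2# * x + 1#) ≡ c * (2# * y + 1#) → x ≡ y
  linear-injective c≢0 eq = *-cancelˡ 2≢0 (+-cancelʳ 1# _ _ (*-cancelˡ c≢0 eq))

  #A₀₀≤1 : ∀ b → #A K u 0 0 b ≤ 1
  #A₀₀≤1 b = count≤1 elems-unique (A? 0 0 b) λ (ηx , ηx+1 , Dx≡b) (ηy , ηy+1 , Dy≡b) →
    linear-injective u₊≢0 (trans (sym (D₀₀ ηx ηx+1)) (trans Dx≡b (trans (sym Dy≡b) (D₀₀ ηy ηy+1))))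

  #A₁₁≤1 : ∀ b → #A K u 1 1 b ≤ 1
  #A₁₁≤1 b = count≤1 elems-unique (A? 1 1 b) λ (ηx , ηx+1 , Dx≡b) (ηy , ηy+1 , Dy≡b) →
    linear-injective u₋≢0 (trans (sym (D₁₁ ηx ηx+1)) (trans Dx≡b (trans (sym Dy≡b) (D₁₁ ηy ηy+1))))

  2u≢0 : 2# * u ≢ 0#
  2u≢0 = x*y≢0 2≢0 u≢0

  #A₀₁≤2 : ∀ b → #A K u 0 1 b ≤ 2
  #A₀₁≤2 b = count≤2 elems-unique (A? 0 1 b) λ (ηx , ηx+1 , Dx≡b) (ηy , ηy+1 , Dy≡b) (ηz , ηz+1 , Dz≡b) x≢y x≢z →
    quadratic-two-roots (-x≢0 2u≢0) x≢y x≢z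
      (trans (sym (D₀₁ ηx ηx+1)) Dx≡b) (trans (sym (D₀₁ ηy ηy+1)) Dy≡b) (trans (sym (D₀₁ ηz ηz+1)) Dz≡b)

  #A₁₀≤2 : ∀ b → #A K u 1 0 b ≤ 2
  #A₁₀≤2 b = count≤2 elems-unique (A? 1 0 b) λ (ηx , ηx+1 , Dx≡b) (ηy , ηy+1 , Dy≡b) (ηz , ηz+1 , Dz≡b) x≢y x≢z →
    quadratic-two-roots 2u≢0 x≢y x≢z
      (trans (sym (D₁₀ ηx ηx+1)) Dx≡b) (trans (sym (D₁₀ ηy ηy+1)) Dy≡b) (trans (sym (D₁₀ ηz ηz+1)) Dz≡b)

  D0≡u₊ : D 0# ≡ u₊
  D0≡u₊ = trans (D-value η-zero η1) (solve 1 (λ u →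
    (con 0ℤ :+ con 1ℤ) :* (con 0ℤ :+ con 1ℤ) :* (con 1ℤ :+ u :* con 1ℤ) :- con 0ℤ :* con 0ℤ :* (con 1ℤ :+ u :* con 0ℤ)
      := con 1ℤ :+ u) refl u)
    where
    η1 : η K (0# + 1#) ≡ 1ℤ
    η1 = subst (λ t → η K t ≡ 1ℤ) (sym (+-identityˡ 1#)) η1≡1

  D-1≡-u₋ : D (- 1#) ≡ - u₋
  D-1≡-u₋ = trans (D-value η[-1]≡-1 (trans (cong (η K) (-‿inverseˡ 1#)) η-zero)) (solve 1 (λ u →
    (:- con 1ℤ :+ con 1ℤ) :* (:- con 1ℤ :+ con 1ℤ) :* (con 1ℤ :+ u :* con 0ℤ) :- (:- con 1ℤ) :* (:- con 1ℤ) :* (con 1ℤ :+ u :* con -1ℤ)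
      := :- (con 1ℤ :- u)) refl u)

  linear-shifts : ∀ {b c x} → b ≡ c * (2# * x + 1#) → b - c ≡ (2# * c) * x × b + c ≡ (2# * c) * (x + 1#)
  linear-shifts {c = c} {x} refl =
      solve 2 (λ c x → c :* (con (ℤ.+ 2) :* x :+ con 1ℤ) :- c := (con (ℤ.+ 2) :* c) :* x) refl c x
    , solve 2 (λ c x → c :* (con (ℤ.+ 2) :* x :+ con 1ℤ) :+ c := (con (ℤ.+ 2) :* c) :* (x :+ con 1ℤ)) refl c x

  private
    root-shift : ∀ {α β γ b x y} → x ≢ y → quadratic α β γ x ≡ b → quadratic α β γ y ≡ b →
                 ∀ z → b - quadratic α β γ z ≡ (- α) * ((z - x) * (z - y))
    root-shift {α} {β} {γ} {b} {x} {y} x≢y qx≡b qy≡b z = begin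
      b - q z                        ≡⟨ solve 2 (λ b q → b :- q := :- (q :- b)) refl b (q z) ⟩
      - (q z - b)                    ≡⟨ cong -_ (quadratic-factorisation x≢y qx≡b qy≡b z) ⟩
      - (α * ((z - x) * (z - y)))    ≡⟨ solve 2 (λ α p → :- (α :* p) := (:- α) :* p) refl α _ ⟩
      (- α) * ((z - x) * (z - y))    ∎
      where
      open ≡-Reasoning
      q : Carrier → Carrier
      q = quadratic α β γ

  A₀₁-pair-shifts : ∀ {b x y} → x ≢ y → InA 0 1 b x → InA 0 1 b y →
    b - u₋ ≡ (2# * u) * (x * y) × b + u₊ ≡ (2# * u) * ((x + 1#) * (y + 1#))
  A₀₁-pair-shifts {b} {x} {y} x≢y (ηx , ηx+1 , Dx≡b) (ηy , ηy+1 , Dy≡b) =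
      trans (cong (λ t → b - t) q[0]≡u₋) (trans (shift 0#) (solve 3 (λ u x y →
        (:- (:- (con (ℤ.+ 2) :* u))) :* ((con 0ℤ :- x) :* (con 0ℤ :- y)) := (con (ℤ.+ 2) :* u) :* (x :* y)) refl u x y))
    , trans (solve 2 (λ b u → b :+ (con 1ℤ :+ u) := b :- (:- (con 1ℤ :+ u))) refl b u)
      (trans (cong (λ t → b - t) q[-1]≡-u₊) (trans (shift (- 1#)) (solve 3 (λ u x y →
        (:- (:- (con (ℤ.+ 2) :* u))) :* ((:- con 1ℤ :- x) :* (:- con 1ℤ :- y))
            := (con (ℤ.+ 2) :* u) :* ((x :+ con 1ℤ) :* (y :+ con 1ℤ))) refl u x y)))
    where
    q : Carrier → Carrier
    q = quadratic (- (2# * u)) (2# * u₋) u₋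
    shift : ∀ z → b - q z ≡ (- (- (2# * u))) * ((z - x) * (z - y))
    shift = root-shift x≢y (trans (sym (D₀₁ ηx ηx+1)) Dx≡b) (trans (sym (D₀₁ ηy ηy+1)) Dy≡b)
    q[0]≡u₋ : u₋ ≡ q 0#
    q[0]≡u₋ = solve 1 (λ u → con 1ℤ :- u
        := (:- (con (ℤ.+ 2) :* u)) :* (con 0ℤ :* con 0ℤ) :+ (con (ℤ.+ 2) :* (con 1ℤ :- u)) :* con 0ℤ :+ (con 1ℤ :- u)) refl u
    q[-1]≡-u₊ : - u₊ ≡ q (- 1#)
    q[-1]≡-u₊ = solve 1 (λ u → :- (con 1ℤ :+ u)
        := (:- (con (ℤ.+ 2) :* u)) :* (:- con 1ℤ :* :- con 1ℤ) :+ (con (ℤ.+ 2) :* (con 1ℤ :- u)) :* (:- con 1ℤ) :+ (con 1ℤ :- u)) refl u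

  A₁₀-pair-shifts : ∀ {b x y} → x ≢ y → InA 1 0 b x → InA 1 0 b y →
    b - u₊ ≡ (2# * (- u)) * (x * y) × b + u₋ ≡ (2# * (- u)) * ((x + 1#) * (y + 1#))
  A₁₀-pair-shifts {b} {x} {y} x≢y (ηx , ηx+1 , Dx≡b) (ηy , ηy+1 , Dy≡b) =
      trans (cong (λ t → b - t) q[0]≡u₊) (trans (shift 0#) (solve 3 (λ u x y →
        (:- (con (ℤ.+ 2) :* u)) :* ((con 0ℤ :- x) :* (con 0ℤ :- y)) := (con (ℤ.+ 2) :* (:- u)) :* (x :* y)) refl u x y))
    , trans (solve 2 (λ b u → b :+ (con 1ℤ :- u) := b :- (:- (con 1ℤ :- u))) refl b u)
      (trans (cong (λ t → b - t) q[-1]≡-u₋) (trans (shift (- 1#)) (solve 3 (λ u x y →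
        (:- (con (ℤ.+ 2) :* u)) :* ((:- con 1ℤ :- x) :* (:- con 1ℤ :- y))
            := (con (ℤ.+ 2) :* (:- u)) :* ((x :+ con 1ℤ) :* (y :+ con 1ℤ))) refl u x y)))
    where
    q : Carrier → Carrier
    q = quadratic (2# * u) (2# * u₊) u₊
    shift : ∀ z → b - q z ≡ (- (2# * u)) * ((z - x) * (z - y))
    shift = root-shift x≢y (trans (sym (D₁₀ ηx ηx+1)) Dx≡b) (trans (sym (D₁₀ ηy ηy+1)) Dy≡b)
    q[0]≡u₊ : u₊ ≡ q 0#
    q[0]≡u₊ = solve 1 (λ u → con 1ℤ :+ u
        := (con (ℤ.+ 2) :* u) :* (con 0ℤ :* con 0ℤ) :+ (con (ℤ.+ 2) :* (con 1ℤ :+ u)) :* con 0ℤ :+ (con 1ℤ :+ u)) refl u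
    q[-1]≡-u₋ : - u₋ ≡ q (- 1#)
    q[-1]≡-u₋ = solve 1 (λ u → :- (con 1ℤ :- u)
        := (con (ℤ.+ 2) :* u) :* (:- con 1ℤ :* :- con 1ℤ) :+ (con (ℤ.+ 2) :* (con 1ℤ :+ u)) :* (:- con 1ℤ) :+ (con 1ℤ :+ u)) refl u

  private
    i*-1≡-i : ∀ i → i ℤ.* -1ℤ ≡ ℤ.- i
    i*-1≡-i i = trans (ℤ.*-comm i -1ℤ) (ℤ.-1*i≡-i i)

    -- Signs are kept in the form η 2 · s, so that comparing two of them cancels η 2.
    η-2cx≡ : ∀ {a c x s t} → a ≡ (2# * c) * x → η K x ≡ s → η K c ℤ.* s ≡ t → η K a ≡ η K 2# ℤ.* t
    η-2cx≡ {c = c} {x} {s} {t} refl ηx≡s ηc*s≡t = begin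
      η K ((2# * c) * x)                 ≡⟨ η-* (2# * c) x ⟩
      η K (2# * c) ℤ.* η K x             ≡⟨ cong (ℤ._* η K x) (η-* 2# c) ⟩
      (η K 2# ℤ.* η K c) ℤ.* η K x       ≡⟨ ℤ.*-assoc (η K 2#) (η K c) (η K x) ⟩
      η K 2# ℤ.* (η K c ℤ.* η K x)       ≡⟨ cong (λ e → η K 2# ℤ.* (η K c ℤ.* e)) ηx≡s ⟩
      η K 2# ℤ.* (η K c ℤ.* s)           ≡⟨ cong (η K 2# ℤ.*_) ηc*s≡t ⟩
      η K 2# ℤ.* t                       ∎
      where open ≡-Reasoning

    η-*≡ : ∀ {x y s t} → η K x ≡ s → η K y ≡ t → η K (x * y) ≡ s ℤ.* t
    η-*≡ {x} {y} ηx ηy = trans (η-* x y) (cong₂ ℤ._*_ ηx ηy)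

  A₀₀-signs : ∀ {b x} → InA 0 0 b x →
    η K (b - u₊) ≡ η K 2# ℤ.* η K u₊ × η K (b + u₊) ≡ η K 2# ℤ.* η K u₊
  A₀₀-signs (ηx , ηx+1 , Dx≡b) =
    let b-u₊ , b+u₊ = linear-shifts (trans (sym Dx≡b) (D₀₀ ηx ηx+1)) in
    η-2cx≡ b-u₊ ηx (ℤ.*-identityʳ _) , η-2cx≡ b+u₊ ηx+1 (ℤ.*-identityʳ _)

  A₁₁-signs : ∀ {b x} → InA 1 1 b x →
    η K (b - u₋) ≡ η K 2# ℤ.* ℤ.- η K u₋ × η K (b + u₋) ≡ η K 2# ℤ.* ℤ.- η K u₋
  A₁₁-signs (ηx , ηx+1 , Dx≡b) =
    let b-u₋ , b+u₋ = linear-shifts (trans (sym Dx≡b) (D₁₁ ηx ηx+1)) in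
    η-2cx≡ b-u₋ ηx (i*-1≡-i _) , η-2cx≡ b+u₋ ηx+1 (i*-1≡-i _)

  A₀₁-pair-signs : ∀ {b x y} → x ≢ y → InA 0 1 b x → InA 0 1 b y →
    η K (b - u₋) ≡ η K 2# ℤ.* η K u × η K (b + u₊) ≡ η K 2# ℤ.* η K u
  A₀₁-pair-signs {b} {x} {y} x≢y x∈A y∈A =
      η-2cx≡ {c = u} {x * y} (proj₁ shifts) (η-*≡ (proj₁ x∈A) (proj₁ y∈A)) (ℤ.*-identityʳ (η K u))
    , η-2cx≡ {c = u} {(x + 1#) * (y + 1#)} (proj₂ shifts) (η-*≡ (proj₁ (proj₂ x∈A)) (proj₁ (proj₂ y∈A))) (ℤ.*-identityʳ (η K u))
    where
    shifts : b - u₋ ≡ (2# * u) * (x * y) × b + u₊ ≡ (2# * u) * ((x + 1#) * (y + 1#))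
    shifts = A₀₁-pair-shifts x≢y x∈A y∈A

  A₁₀-pair-signs : ∀ {b x y} → x ≢ y → InA 1 0 b x → InA 1 0 b y →
    η K (b - u₊) ≡ η K 2# ℤ.* ℤ.- η K u × η K (b + u₋) ≡ η K 2# ℤ.* ℤ.- η K u
  A₁₀-pair-signs {b} {x} {y} x≢y x∈A y∈A =
      η-2cx≡ {c = - u} {x * y} (proj₁ shifts) (η-*≡ (proj₁ x∈A) (proj₁ y∈A)) ηc
    , η-2cx≡ {c = - u} {(x + 1#) * (y + 1#)} (proj₂ shifts) (η-*≡ (proj₁ (proj₂ x∈A)) (proj₁ (proj₂ y∈A))) ηc
    where
    shifts : b - u₊ ≡ (2# * (- u)) * (x * y) × b + u₋ ≡ (2# * (- u)) * ((x + 1#) * (y + 1#))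
    shifts = A₁₀-pair-shifts x≢y x∈A y∈A
    ηc : η K (- u) ℤ.* 1ℤ ≡ ℤ.- η K u
    ηc = trans (ℤ.*-identityʳ (η K (- u))) (η-neg u)

  at-0-signs : ∀ {b} → b ≡ u₊ → η K (b - u₋) ≡ η K 2# ℤ.* η K u × η K (b + u₋) ≡ η K 2# ℤ.* 1ℤ
  at-0-signs refl =
      η-2cx≡ (solve 1 (λ u → (con 1ℤ :+ u) :- (con 1ℤ :- u) := (con (ℤ.+ 2) :* u) :* con 1ℤ) refl u) η1≡1 (ℤ.*-identityʳ _)
    , η-2cx≡ (solve 1 (λ u → (con 1ℤ :+ u) :+ (con 1ℤ :- u) := (con (ℤ.+ 2) :* con 1ℤ) :* con 1ℤ) refl u) η1≡1
             (trans (ℤ.*-identityʳ _) η1≡1)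

  at-1-signs : ∀ {b} → b ≡ - u₋ → η K (b - u₊) ≡ η K 2# ℤ.* -1ℤ × η K (b + u₊) ≡ η K 2# ℤ.* η K u
  at-1-signs refl =
      η-2cx≡ (solve 1 (λ u → :- (con 1ℤ :- u) :- (con 1ℤ :+ u) := (con (ℤ.+ 2) :* :- con 1ℤ) :* con 1ℤ) refl u) η1≡1
             (trans (ℤ.*-identityʳ _) η[-1]≡-1)
    , η-2cx≡ (solve 1 (λ u → :- (con 1ℤ :- u) :+ (con 1ℤ :+ u) := (con (ℤ.+ 2) :* u) :* con 1ℤ) refl u) η1≡1 (ℤ.*-identityʳ _)

  A₁₀-at-0 : ∀ {b x} → b ≡ u₊ → InA 1 0 b x → η K u ≡ -1ℤ
  A₁₀-at-0 {b} {x} refl (ηx , ηx+1 , Dx≡b) = ℤ.*-cancelʳ-≡ (η K u) -1ℤ 1ℤ (begin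
    η K u ℤ.* 1ℤ                 ≡⟨ η-*≡ refl ηx+1 ⟨
    η K (u * (x + 1#))           ≡⟨ cong (η K) (x+1≡0⇒x≡-1 u[x+1]+1≡0) ⟩
    η K (- 1#)                   ≡⟨ η[-1]≡-1 ⟩
    -1ℤ ℤ.* 1ℤ                   ∎)
    where
    open ≡-Reasoning
    factor : (2# * x) * (u * (x + 1#) + 1#) ≡ quadratic (2# * u) (2# * u₊) u₊ x - u₊
    factor = solve 2 (λ x u → (con (ℤ.+ 2) :* x) :* (u :* (x :+ con 1ℤ) :+ con 1ℤ)
      := (con (ℤ.+ 2) :* u) :* (x :* x) :+ (con (ℤ.+ 2) :* (con 1ℤ :+ u)) :* x :+ (con 1ℤ :+ u) :- (con 1ℤ :+ u)) refl x u
    u[x+1]+1≡0 : u * (x + 1#) + 1# ≡ 0#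
    u[x+1]+1≡0 = xy≡0⇒y≡0 (x*y≢0 2≢0 (η≡±1⇒≢0 1 ηx))
      (trans factor (x≡y⇒x-y≡0 (trans (sym (D₁₀ ηx ηx+1)) Dx≡b)))

  A₁₀-at-1 : ∀ {b x} → b ≡ - u₋ → InA 1 0 b x → η K u ≡ 1ℤ
  A₁₀-at-1 {b} {x} refl (ηx , ηx+1 , Dx≡b) = ℤ.*-cancelʳ-≡ (η K u) 1ℤ -1ℤ (begin
    η K u ℤ.* -1ℤ                ≡⟨ η-*≡ refl ηx ⟨
    η K (u * x)                  ≡⟨ cong (η K) (x+1≡0⇒x≡-1 ux+1≡0) ⟩
    η K (- 1#)                   ≡⟨ η[-1]≡-1 ⟩
    1ℤ ℤ.* -1ℤ                   ∎)
    where
    open ≡-Reasoning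
    factor : (2# * (x + 1#)) * (u * x + 1#) ≡ quadratic (2# * u) (2# * u₊) u₊ x + u₋
    factor = solve 2 (λ x u → (con (ℤ.+ 2) :* (x :+ con 1ℤ)) :* (u :* x :+ con 1ℤ)
      := (con (ℤ.+ 2) :* u) :* (x :* x) :+ (con (ℤ.+ 2) :* (con 1ℤ :+ u)) :* x :+ (con 1ℤ :+ u) :+ (con 1ℤ :- u)) refl x u
    ux+1≡0 : u * x + 1# ≡ 0#
    ux+1≡0 = xy≡0⇒y≡0 (x*y≢0 2≢0 (η≡±1⇒≢0 0 ηx+1))
      (trans factor (trans (cong (_+ u₋) (trans (sym (D₁₀ ηx ηx+1)) Dx≡b)) (-‿inverseˡ u₋)))

  private
    nonzero-pair-shift : ∀ {a c x y} → a ≡ (2# * c) * (x * y) → c ≢ 0# → x ≢ 0# → y ≢ 0# → a ≢ 0#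
    nonzero-pair-shift a≡ c≢0 x≢0 y≢0 a≡0 = x*y≢0 (x*y≢0 2≢0 c≢0) (x*y≢0 x≢0 y≢0) (trans (sym a≡) a≡0)

    at-most-one : ∀ {P : Pred Carrier 0ℓ} (P? : Decidable P) → (∀ {x y} → P x → P y → x ≢ y → ⊥) → # P? ≤ 1
    at-most-one P? no-pair = count≤1 elems-unique P? λ {x} {y} Px Py → decidable-stable (x ≟ y) (no-pair Px Py)

  at-0-excludes : ∀ {b} → b ≡ u₊ →
    #A K u 0 0 b ≡ 0 × #A K u 1 0 b ≤ 1 × (1 ≤ #A K u 1 1 b → #A K u 1 0 b ≡ 0)
  at-0-excludes {b} b≡u₊ =
      count≡0 (A? 0 0 b) (λ x (ηx , ηx+1 , Dx≡b) →
        let b-u₊ = proj₁ (linear-shifts (trans (sym Dx≡b) (D₀₀ ηx ηx+1))) in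
        x*y≢0 (x*y≢0 2≢0 u₊≢0) (η≡±1⇒≢0 0 ηx) (trans (sym b-u₊) (x≡y⇒x-y≡0 b≡u₊))) elems
    , at-most-one (A? 1 0 b) (λ x∈A@(ηx , _) y∈A@(ηy , _) x≢y →
        nonzero-pair-shift (proj₁ (A₁₀-pair-shifts x≢y x∈A y∈A)) (-x≢0 u≢0) (η≡±1⇒≢0 1 ηx) (η≡±1⇒≢0 1 ηy)
          (x≡y⇒x-y≡0 b≡u₊))
    , λ 1≤#A₁₁ → count≡0 (A? 1 0 b) (λ y y∈A →
        let x , x∈A = count-witness (A? 1 1 b) elems 1≤#A₁₁ in
        1ℤ≢-1ℤ (trans (sym (η-cancelˡ 2≢0 (begin
          η K 2# ℤ.* η K u           ≡⟨ proj₁ (at-0-signs b≡u₊) ⟨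
          η K (b - u₋)               ≡⟨ proj₁ (A₁₁-signs x∈A) ⟩
          η K 2# ℤ.* ℤ.- η K u₋      ≡⟨ proj₂ (A₁₁-signs x∈A) ⟨
          η K (b + u₋)               ≡⟨ proj₂ (at-0-signs b≡u₊) ⟩
          η K 2# ℤ.* 1ℤ              ∎))) (A₁₀-at-0 b≡u₊ y∈A))) elems
    where open ≡-Reasoning

  at-1-excludes : ∀ {b} → b ≡ - u₋ →
    #A K u 1 1 b ≡ 0 × #A K u 1 0 b ≤ 1 × (1 ≤ #A K u 0 0 b → #A K u 1 0 b ≡ 0)
  at-1-excludes {b} b≡-u₋ =
      count≡0 (A? 1 1 b) (λ x (ηx , ηx+1 , Dx≡b) →
        let b+u₋ = proj₂ (linear-shifts (trans (sym Dx≡b) (D₁₁ ηx ηx+1))) in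
        x*y≢0 (x*y≢0 2≢0 u₋≢0) (η≡±1⇒≢0 1 ηx+1) (trans (sym b+u₋) b+u₋≡0)) elems
    , at-most-one (A? 1 0 b) (λ x∈A@(_ , ηx+1 , _) y∈A@(_ , ηy+1 , _) x≢y →
        nonzero-pair-shift (proj₂ (A₁₀-pair-shifts x≢y x∈A y∈A)) (-x≢0 u≢0) (η≡±1⇒≢0 0 ηx+1) (η≡±1⇒≢0 0 ηy+1)
          b+u₋≡0)
    , λ 1≤#A₀₀ → count≡0 (A? 1 0 b) (λ y y∈A →
        let x , x∈A = count-witness (A? 0 0 b) elems 1≤#A₀₀ in
        1ℤ≢-1ℤ (trans (sym (A₁₀-at-1 b≡-u₋ y∈A)) (sym (η-cancelˡ 2≢0 (begin
          η K 2# ℤ.* -1ℤ             ≡⟨ proj₁ (at-1-signs b≡-u₋) ⟨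
          η K (b - u₊)               ≡⟨ proj₁ (A₀₀-signs x∈A) ⟩
          η K 2# ℤ.* η K u₊          ≡⟨ proj₂ (A₀₀-signs x∈A) ⟨
          η K (b + u₊)               ≡⟨ proj₂ (at-1-signs b≡-u₋) ⟩
          η K 2# ℤ.* η K u           ∎))))) elems
    where
    open ≡-Reasoning
    b+u₋≡0 : b + u₋ ≡ 0#
    b+u₋≡0 = trans (cong (_+ u₋) b≡-u₋) (-‿inverseˡ u₋)

  not-at-0-and-at-1 : ∀ {b} → b ≡ u₊ → b ≡ - u₋ → ⊥
  not-at-0-and-at-1 b≡u₊ b≡-u₋ = 2≢0 (trans (solve 1 (λ u → con (ℤ.+ 2) := (con 1ℤ :+ u) :- (:- (con 1ℤ :- u))) refl u)
                                           (x≡y⇒x-y≡0 (trans (sym b≡u₊) b≡-u₋)))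

  private
    pair : ∀ {i j b} → #A K u i j b ≡ 2 → ∃₂ λ x y → x ≢ y × InA i j b x × InA i j b y
    pair {i} {j} {b} #≡2 with count≡2-witnesses elems-unique (A? i j b) #≡2
    ... | x , y , x∈A , y∈A , x≢y = x , y , x≢y , x∈A , y∈A

  two-pairs-exclude : ∀ {b} → #A K u 0 1 b ≡ 2 → #A K u 1 0 b ≡ 2 → #A K u 0 0 b ≡ 0 × #A K u 1 1 b ≡ 0
  two-pairs-exclude {b} #A₀₁≡2 #A₁₀≡2 with pair {0} {1} #A₀₁≡2 | pair {1} {0} #A₁₀≡2
  ... | _ , _ , x≢y , x∈A₀₁ , y∈A₀₁ | _ , _ , x′≢y′ , x′∈A₁₀ , y′∈A₁₀ =
      count≡0 (A? 0 0 b) (λ z z∈A → η≢-η u≢0 (sym (η-cancelˡ 2≢0 (begin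
        η K 2# ℤ.* ℤ.- η K u   ≡⟨ proj₁ (A₁₀-pair-signs x′≢y′ x′∈A₁₀ y′∈A₁₀) ⟨
        η K (b - u₊)           ≡⟨ proj₁ (A₀₀-signs z∈A) ⟩
        η K 2# ℤ.* η K u₊      ≡⟨ proj₂ (A₀₀-signs z∈A) ⟨
        η K (b + u₊)           ≡⟨ proj₂ (A₀₁-pair-signs x≢y x∈A₀₁ y∈A₀₁) ⟩
        η K 2# ℤ.* η K u       ∎)))) elems
    , count≡0 (A? 1 1 b) (λ z z∈A → η≢-η u≢0 (η-cancelˡ 2≢0 (begin
        η K 2# ℤ.* η K u          ≡⟨ proj₁ (A₀₁-pair-signs x≢y x∈A₀₁ y∈A₀₁) ⟨
        η K (b - u₋)              ≡⟨ proj₁ (A₁₁-signs z∈A) ⟩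
        η K 2# ℤ.* ℤ.- η K u₋     ≡⟨ proj₂ (A₁₁-signs z∈A) ⟨
        η K (b + u₋)              ≡⟨ proj₂ (A₁₀-pair-signs x′≢y′ x′∈A₁₀ y′∈A₁₀) ⟩
        η K 2# ℤ.* ℤ.- η K u      ∎))) elems
    where open ≡-Reasoning

  full-with-pair₀₁ : ∀ {b} → 1 ≤ #A K u 0 0 b → 1 ≤ #A K u 1 1 b → #A K u 0 1 b ≡ 2 →
    η K u₊ ≡ η K u × η K u₋ ≡ ℤ.- η K u
  full-with-pair₀₁ {b} 1≤#A₀₀ 1≤#A₁₁ #A₀₁≡2
    with count-witness (A? 0 0 b) elems 1≤#A₀₀ | count-witness (A? 1 1 b) elems 1≤#A₁₁ | pair {0} {1} #A₀₁≡2
  ... | _ , x∈A₀₀ | _ , y∈A₁₁ | _ , _ , z≢w , z∈A₀₁ , w∈A₀₁ =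
      η-cancelˡ 2≢0 (trans (sym (proj₂ (A₀₀-signs x∈A₀₀))) (proj₂ (A₀₁-pair-signs z≢w z∈A₀₁ w∈A₀₁)))
    , trans (sym (ℤ.neg-involutive _)) (cong ℤ.-_
        (η-cancelˡ 2≢0 (trans (sym (proj₁ (A₁₁-signs y∈A₁₁))) (proj₁ (A₀₁-pair-signs z≢w z∈A₀₁ w∈A₀₁)))))

  full-with-pair₁₀ : ∀ {b} → 1 ≤ #A K u 0 0 b → 1 ≤ #A K u 1 1 b → #A K u 1 0 b ≡ 2 →
    η K u₊ ≡ ℤ.- η K u × η K u₋ ≡ η K u
  full-with-pair₁₀ {b} 1≤#A₀₀ 1≤#A₁₁ #A₁₀≡2
    with count-witness (A? 0 0 b) elems 1≤#A₀₀ | count-witness (A? 1 1 b) elems 1≤#A₁₁ | pair {1} {0} #A₁₀≡2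
  ... | _ , x∈A₀₀ | _ , y∈A₁₁ | _ , _ , z≢w , z∈A₁₀ , w∈A₁₀ =
      η-cancelˡ 2≢0 (trans (sym (proj₁ (A₀₀-signs x∈A₀₀))) (proj₁ (A₁₀-pair-signs z≢w z∈A₁₀ w∈A₁₀)))
    , ℤ.neg-injective (η-cancelˡ 2≢0 (trans (sym (proj₂ (A₁₁-signs y∈A₁₁))) (proj₂ (A₁₀-pair-signs z≢w z∈A₁₀ w∈A₁₀))))

  δ₁ : Carrier → ℕ
  δ₁ b = δ K F 1# b

  Solution? : ∀ b → Decidable (λ x → D x ≡ b)
  Solution? b x = D x ≟ b

  AtZero? : ∀ b → Decidable (λ x → D x ≡ b × x ≡ 0#)
  AtZero? b = Solution? b ∩? (_≟ 0#)

  OffZero? : ∀ b → Decidable (λ x → D x ≡ b × x ≢ 0#)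
  OffZero? b = Solution? b ∩? ∁? (_≟ 0#)

  AtMinusOne? : ∀ b → Decidable (λ x → (D x ≡ b × x ≢ 0#) × x + 1# ≡ 0#)
  AtMinusOne? b = OffZero? b ∩? λ x → (x + 1#) ≟ 0#

  Generic? : ∀ b → Decidable (λ x → (D x ≡ b × x ≢ 0#) × x + 1# ≢ 0#)
  Generic? b = OffZero? b ∩? ∁? λ x → (x + 1#) ≟ 0#

  Sign? : ∀ i → Decidable (λ x → η K x ≡ sgn K i)
  Sign? i x = η K x ℤ.≟ sgn K i

  Sign⁺? : ∀ j → Decidable (λ x → η K (x + 1#) ≡ sgn K j)
  Sign⁺? j x = η K (x + 1#) ℤ.≟ sgn K j

  private
    sign-disjoint : ∀ {s} → s ≡ sgn K 0 → s ≡ sgn K 1 → ⊥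
    sign-disjoint s≡1 s≡-1 = 1ℤ≢-1ℤ (trans (sym s≡1) s≡-1)

    interchange : ∀ a b c d → (a ℕ.+ b) ℕ.+ (c ℕ.+ d) ≡ (a ℕ.+ d) ℕ.+ (b ℕ.+ c)
    interchange = solve-∀

  generic-decomposition : ∀ b →
    # (Generic? b) ≡ (#A K u 0 0 b ℕ.+ #A K u 1 1 b) ℕ.+ (#A K u 0 1 b ℕ.+ #A K u 1 0 b)
  generic-decomposition b = begin
    # (Generic? b)
      ≡⟨ count-partition (Generic? b) (Sign? 0) (Sign? 1) (λ ((_ , x≢0) , _) → η-≢0 x≢0) sign-disjoint elems ⟩
    # (Generic? b ∩? Sign? 0) ℕ.+ # (Generic? b ∩? Sign? 1)
      ≡⟨ cong₂ ℕ._+_ (split 0) (split 1) ⟩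
    (# (cell 0 0) ℕ.+ # (cell 0 1)) ℕ.+ (# (cell 1 0) ℕ.+ # (cell 1 1))
      ≡⟨ cong₂ ℕ._+_ (cong₂ ℕ._+_ (cell≡A 0 0) (cell≡A 0 1)) (cong₂ ℕ._+_ (cell≡A 1 0) (cell≡A 1 1)) ⟩
    (#A K u 0 0 b ℕ.+ #A K u 0 1 b) ℕ.+ (#A K u 1 0 b ℕ.+ #A K u 1 1 b)
      ≡⟨ interchange (#A K u 0 0 b) (#A K u 0 1 b) (#A K u 1 0 b) (#A K u 1 1 b) ⟩
    (#A K u 0 0 b ℕ.+ #A K u 1 1 b) ℕ.+ (#A K u 0 1 b ℕ.+ #A K u 1 0 b)
      ∎
    where
    open ≡-Reasoning
    cell : ∀ i j → Decidable (λ x → (((D x ≡ b × x ≢ 0#) × x + 1# ≢ 0#) × η K x ≡ sgn K i) × η K (x + 1#) ≡ sgn K j)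
    cell i j = (Generic? b ∩? Sign? i) ∩? Sign⁺? j
    split : ∀ i → # (Generic? b ∩? Sign? i) ≡ # (cell i 0) ℕ.+ # (cell i 1)
    split i = count-partition (Generic? b ∩? Sign? i) (Sign⁺? 0) (Sign⁺? 1)
                (λ ((_ , x+1≢0) , _) → η-≢0 x+1≢0) sign-disjoint elems
    cell≡A : ∀ i j → # (cell i j) ≡ #A K u i j b
    cell≡A i j = count-cong (cell i j) (A? i j b)
      ( (λ ((((Dx≡b , _) , _) , ηx) , ηx+1) → ηx , ηx+1 , Dx≡b)
      , (λ (ηx , ηx+1 , Dx≡b) → (((Dx≡b , η≡±1⇒≢0 i ηx) , η≡±1⇒≢0 j ηx+1) , ηx) , ηx+1)) elems

  δ₁-decomposition : ∀ b → δ₁ b ≡ # (AtZero? b) ℕ.+ (# (AtMinusOne? b) ℕ.+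
    ((#A K u 0 0 b ℕ.+ #A K u 1 1 b) ℕ.+ (#A K u 0 1 b ℕ.+ #A K u 1 0 b)))
  δ₁-decomposition b = trans (count-split (Solution? b) (_≟ 0#) elems) (cong (# (AtZero? b) ℕ.+_)
    (trans (count-split (OffZero? b) (λ x → (x + 1#) ≟ 0#) elems) (cong (# (AtMinusOne? b) ℕ.+_) (generic-decomposition b))))

  #AtZero≤1 : ∀ b → # (AtZero? b) ≤ 1
  #AtZero≤1 b = count≤1 elems-unique (AtZero? b) λ (_ , x≡0) (_ , y≡0) → trans x≡0 (sym y≡0)

  AtZero⇒b≡u₊ : ∀ {b} → 1 ≤ # (AtZero? b) → b ≡ u₊
  AtZero⇒b≡u₊ {b} 1≤# =
    let x , Dx≡b , x≡0 = count-witness (AtZero? b) elems 1≤# in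
    trans (sym Dx≡b) (trans (cong D x≡0) D0≡u₊)

  #AtMinusOne≤1 : ∀ b → # (AtMinusOne? b) ≤ 1
  #AtMinusOne≤1 b = count≤1 elems-unique (AtMinusOne? b) λ (_ , x+1≡0) (_ , y+1≡0) →
    trans (x+1≡0⇒x≡-1 x+1≡0) (sym (x+1≡0⇒x≡-1 y+1≡0))

  AtMinusOne⇒b≡-u₋ : ∀ {b} → 1 ≤ # (AtMinusOne? b) → b ≡ - u₋
  AtMinusOne⇒b≡-u₋ {b} 1≤# =
    let x , (Dx≡b , _) , x+1≡0 = count-witness (AtMinusOne? b) elems 1≤# in
    trans (sym Dx≡b) (trans (cong D (x+1≡0⇒x≡-1 x+1≡0)) D-1≡-u₋)

  FivePattern : Carrier → Set
  FivePattern b = #A K u 0 0 b ≡ 1 × #A K u 1 1 b ≡ 1 ×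
    (#A K u 0 1 b ≡ 2 × #A K u 1 0 b ≡ 1 ⊎ #A K u 0 1 b ≡ 1 × #A K u 1 0 b ≡ 2)

  δ₁-structure : ∀ b → δ₁ b ≤ 5 × (δ₁ b ≡ 5 → FivePattern b)
  δ₁-structure b rewrite δ₁-decomposition b =
    solution-count (#AtZero≤1 b) (#AtMinusOne≤1 b) (#A₀₀≤1 b) (#A₁₁≤1 b) (#A₀₁≤2 b) (#A₁₀≤2 b)
      (λ 1≤e₀ 1≤e₁ → not-at-0-and-at-1 (AtZero⇒b≡u₊ 1≤e₀) (AtMinusOne⇒b≡-u₋ 1≤e₁))
      (λ 1≤e₀ → at-0-excludes (AtZero⇒b≡u₊ 1≤e₀))
      (λ 1≤e₁ → at-1-excludes (AtMinusOne⇒b≡-u₋ 1≤e₁))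
      (λ #A₀₁≡2 #A₁₀≡2 → let #A₀₀≡0 , #A₁₁≡0 = two-pairs-exclude #A₀₁≡2 #A₁₀≡2 in cong₂ ℕ._+_ #A₀₀≡0 #A₁₁≡0)

  private
    absent : ∀ {n} → n ≤ 1 → ¬ (1 ≤ n) → n ≡ 0
    absent z≤n       _    = refl
    absent (s≤s z≤n) ¬1≤n = ⊥-elim (¬1≤n (s≤s z≤n))

    present : ∀ {n} → n ≡ 1 → 1 ≤ n
    present refl = s≤s z≤n

  δ₁≡5-if : ∀ {b} → #A K u 0 0 b ≡ 1 → #A K u 1 1 b ≡ 1 → #A K u 0 1 b ℕ.+ #A K u 1 0 b ≡ 3 → δ₁ b ≡ 5
  δ₁≡5-if {b} #A₀₀≡1 #A₁₁≡1 sum≡3 = trans (δ₁-decomposition b)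
    (cong₂ ℕ._+_ e₀≡0 (cong₂ ℕ._+_ e₁≡0 (cong₂ ℕ._+_ (cong₂ ℕ._+_ #A₀₀≡1 #A₁₁≡1) sum≡3)))
    where
    e₀≡0 : # (AtZero? b) ≡ 0
    e₀≡0 = absent (#AtZero≤1 b) λ 1≤e₀ → ℕ.1+n≢0 (trans (sym #A₀₀≡1) (proj₁ (at-0-excludes (AtZero⇒b≡u₊ 1≤e₀))))
    e₁≡0 : # (AtMinusOne? b) ≡ 0
    e₁≡0 = absent (#AtMinusOne≤1 b) λ 1≤e₁ → ℕ.1+n≢0 (trans (sym #A₁₁≡1) (proj₁ (at-1-excludes (AtMinusOne⇒b≡-u₋ 1≤e₁))))

  δ₁≤5 : ∀ b → δ₁ b ≤ 5
  δ₁≤5 b = proj₁ (δ₁-structure b)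

  δ₁≤4 : η K u₊ ≡ η K u₋ → ∀ b → δ₁ b ≤ 4
  δ₁≤4 η₊≡η₋ b = ℕ.≤-pred (ℕ.≤∧≢⇒< (δ₁≤5 b) λ δ₁≡5 → impossible (proj₂ (δ₁-structure b) δ₁≡5))
    where
    impossible : ¬ FivePattern b
    impossible (#A₀₀≡1 , #A₁₁≡1 , inj₁ (#A₀₁≡2 , _)) =
      let η₊≡ηu , η₋≡-ηu = full-with-pair₀₁ (present #A₀₀≡1) (present #A₁₁≡1) #A₀₁≡2 in
      η≢-η u₊≢0 (trans η₊≡η₋ (trans η₋≡-ηu (cong ℤ.-_ (sym η₊≡ηu))))
    impossible (#A₀₀≡1 , #A₁₁≡1 , inj₂ (_ , #A₁₀≡2)) =
      let η₊≡-ηu , η₋≡ηu = full-with-pair₁₀ (present #A₀₀≡1) (present #A₁₁≡1) #A₁₀≡2 in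
      η≢-η u₊≢0 (trans η₊≡-ηu (cong ℤ.-_ (trans (sym η₋≡ηu) (sym η₊≡η₋))))

  δ₁≡5-case₂ : η K (1# + u) ≡ η K (u - 1#) → η K (u - 1#) ≡ η K u → ∀ b →
    (δ₁ b ≡ 5) ⇔ (#A K u 0 0 b ≡ 1 × #A K u 1 1 b ≡ 1 × #A K u 1 0 b ≡ 1 × #A K u 0 1 b ≡ 2)
  δ₁≡5-case₂ h₁ h₂ b = mk⇔ (λ δ₁≡5 → select (proj₂ (δ₁-structure b) δ₁≡5))
    λ (#A₀₀≡1 , #A₁₁≡1 , #A₁₀≡1 , #A₀₁≡2) → δ₁≡5-if #A₀₀≡1 #A₁₁≡1 (cong₂ ℕ._+_ #A₀₁≡2 #A₁₀≡1)
    where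
    select : FivePattern b → #A K u 0 0 b ≡ 1 × #A K u 1 1 b ≡ 1 × #A K u 1 0 b ≡ 1 × #A K u 0 1 b ≡ 2
    select (#A₀₀≡1 , #A₁₁≡1 , inj₁ (#A₀₁≡2 , #A₁₀≡1)) = #A₀₀≡1 , #A₁₁≡1 , #A₁₀≡1 , #A₀₁≡2
    select (#A₀₀≡1 , #A₁₁≡1 , inj₂ (_ , #A₁₀≡2)) =
      ⊥-elim (η≢-η u≢0 (trans (sym (trans h₁ h₂)) (proj₁ (full-with-pair₁₀ (present #A₀₀≡1) (present #A₁₁≡1) #A₁₀≡2))))

  δ₁≡5-case₃ : η K (1# + u) ≡ η K (u - 1#) → η K (u - 1#) ≡ ℤ.- η K u → ∀ b →
    (δ₁ b ≡ 5) ⇔ (#A K u 0 0 b ≡ 1 × #A K u 1 1 b ≡ 1 × #A K u 0 1 b ≡ 1 × #A K u 1 0 b ≡ 2)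
  δ₁≡5-case₃ h₁ h₂ b = mk⇔ (λ δ₁≡5 → select (proj₂ (δ₁-structure b) δ₁≡5))
    λ (#A₀₀≡1 , #A₁₁≡1 , #A₀₁≡1 , #A₁₀≡2) → δ₁≡5-if #A₀₀≡1 #A₁₁≡1 (cong₂ ℕ._+_ #A₀₁≡1 #A₁₀≡2)
    where
    select : FivePattern b → #A K u 0 0 b ≡ 1 × #A K u 1 1 b ≡ 1 × #A K u 0 1 b ≡ 1 × #A K u 1 0 b ≡ 2
    select (#A₀₀≡1 , #A₁₁≡1 , inj₂ (#A₀₁≡1 , #A₁₀≡2)) = #A₀₀≡1 , #A₁₁≡1 , #A₀₁≡1 , #A₁₀≡2
    select (#A₀₀≡1 , #A₁₁≡1 , inj₁ (#A₀₁≡2 , _)) =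
      ⊥-elim (η≢-η u≢0 (trans (sym (proj₁ (full-with-pair₀₁ (present #A₀₀≡1) (present #A₁₁≡1) #A₀₁≡2))) (trans h₁ h₂)))

  F-homogeneous : ∀ {c} → η K c ≡ 1ℤ → ∀ z → F (c * z) ≡ (c * c) * F z
  F-homogeneous {c} ηc≡1 z = begin
    F (c * z)                                 ≡⟨ F-value (trans (η-* c z) (trans (cong (ℤ._* η K z) ηc≡1) (ℤ.*-identityˡ (η K z)))) ⟩
    (c * z) * (c * z) * (1# + u * ι (η K z))  ≡⟨ solve 4 (λ c z u w → (c :* z) :* (c :* z) :* (con 1ℤ :+ u :* w)
                                                   := (c :* c) :* (z :* z :* (con 1ℤ :+ u :* w))) refl c z u (ι (η K z)) ⟩
    (c * c) * (z * z * (1# + u * ι (η K z)))  ≡⟨ cong ((c * c) *_) (F-value refl) ⟨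
    (c * c) * F z                             ∎
    where open ≡-Reasoning

  D-homogeneous : ∀ {c} → η K c ≡ 1ℤ → ∀ y → (c * c) * D y ≡ F (c * y + c) - F (c * y)
  D-homogeneous {c} ηc≡1 y = begin
    (c * c) * (F (y + 1#) - F y)               ≡⟨ solve 3 (λ k p q → k :* (p :- q)
        := k :* p :- k :* q) refl (c * c) (F (y + 1#)) (F y) ⟩
    (c * c) * F (y + 1#) - (c * c) * F y       ≡⟨ cong₂ _-_ (F-homogeneous ηc≡1 (y + 1#)) (F-homogeneous ηc≡1 y) ⟨
    F (c * (y + 1#)) - F (c * y)
      ≡⟨ cong (λ t → F t - F (c * y)) (solve 2 (λ c y → c :* (y :+ con 1ℤ) := c :* y :+ c) refl c y) ⟩
    F (c * y + c) - F (c * y)                  ∎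
    where open ≡-Reasoning

  private
    inverse-cancel : ∀ {c c⁻¹} → c * c⁻¹ ≡ 1# → ∀ x → c * (c⁻¹ * x) ≡ x
    inverse-cancel {c} {c⁻¹} cc⁻¹≡1 x = trans (sym (*-assoc c c⁻¹ x)) (trans (cong (_* x) cc⁻¹≡1) (*-identityˡ x))

    unscale : ∀ {c c⁻¹ w v} → c * c⁻¹ ≡ 1# → (c * c) * w ≡ v → w ≡ (c⁻¹ * c⁻¹) * v
    unscale {c} {c⁻¹} {w} {v} cc⁻¹≡1 ccw≡v = begin
      w                                ≡⟨ solve 1 (λ w → w := (con 1ℤ :* con 1ℤ) :* w) refl w ⟩
      (1# * 1#) * w                    ≡⟨ cong (λ e → (e * e) * w) cc⁻¹≡1 ⟨
      ((c * c⁻¹) * (c * c⁻¹)) * w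
        ≡⟨ solve 3 (λ c c⁻¹ w → ((c :* c⁻¹) :* (c :* c⁻¹)) :* w := (c⁻¹ :* c⁻¹) :* ((c :* c) :* w)) refl c c⁻¹ w ⟩
      (c⁻¹ * c⁻¹) * ((c * c) * w)      ≡⟨ cong ((c⁻¹ * c⁻¹) *_) ccw≡v ⟩
      (c⁻¹ * c⁻¹) * v                  ∎
      where open ≡-Reasoning

    inverse≢0 : ∀ {c c⁻¹} → c * c⁻¹ ≡ 1# → c⁻¹ ≢ 0#
    inverse≢0 {c} cc⁻¹≡1 c⁻¹≡0 = 1≢0 (trans (sym cc⁻¹≡1) (trans (cong (c *_) c⁻¹≡0) (zeroʳ c)))

    δ≤δ₁-square : ∀ {a} → η K a ≡ 1ℤ → (∃ λ a⁻¹ → a * a⁻¹ ≡ 1#) → ∀ b → ∃ λ b′ → δ K F a b ≤ δ₁ b′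
    δ≤δ₁-square {a} ηa≡1 (a⁻¹ , aa⁻¹≡1) b =
      (a⁻¹ * a⁻¹) * b , count-≤-injection elems-unique elems-complete (λ x → (F (x + a) - F x) ≟ b) (Solution? _)
        (a⁻¹ *_) solution (λ _ _ → *-cancelˡ (inverse≢0 aa⁻¹≡1))
      where
      open ≡-Reasoning
      solution : ∀ {x} → F (x + a) - F x ≡ b → D (a⁻¹ * x) ≡ (a⁻¹ * a⁻¹) * b
      solution {x} Fx+a-Fx≡b = unscale aa⁻¹≡1 (begin
        (a * a) * D (a⁻¹ * x)                     ≡⟨ D-homogeneous ηa≡1 (a⁻¹ * x) ⟩
        F (a * (a⁻¹ * x) + a) - F (a * (a⁻¹ * x)) ≡⟨ cong (λ t → F (t + a) - F t) (inverse-cancel aa⁻¹≡1 x) ⟩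
        F (x + a) - F x                           ≡⟨ Fx+a-Fx≡b ⟩
        b                                         ∎)

    δ≤δ₁-nonsquare : ∀ {a} → η K (- a) ≡ 1ℤ → (∃ λ c⁻¹ → - a * c⁻¹ ≡ 1#) → ∀ b → ∃ λ b′ → δ K F a b ≤ δ₁ b′
    δ≤δ₁-nonsquare {a} ηc≡1 (c⁻¹ , cc⁻¹≡1) b =
      (c⁻¹ * c⁻¹) * (- b) , count-≤-injection elems-unique elems-complete (λ x → (F (x + a) - F x) ≟ b) (Solution? _)
        (λ x → c⁻¹ * x - 1#) solution (λ _ _ e → *-cancelˡ (inverse≢0 cc⁻¹≡1) (+-cancelʳ (- 1#) _ _ e))
      where
      open ≡-Reasoning
      c : Carrier
      c = - a
      shifted : ∀ x → c * (c⁻¹ * x - 1#) ≡ x + a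
      shifted x = begin
        c * (c⁻¹ * x - 1#)   ≡⟨ solve 3 (λ c c⁻¹ x → c :* (c⁻¹ :* x :- con 1ℤ) := c :* (c⁻¹ :* x) :- c) refl c c⁻¹ x ⟩
        c * (c⁻¹ * x) - c    ≡⟨ cong (λ t → t - c) (inverse-cancel cc⁻¹≡1 x) ⟩
        x - - a              ≡⟨ cong (x +_) (-‿involutive a) ⟩
        x + a                ∎
      shifted-back : ∀ x → c * (c⁻¹ * x - 1#) + c ≡ x
      shifted-back x = trans (solve 3 (λ c c⁻¹ x → c :* (c⁻¹ :* x :- con 1ℤ) :+ c := c :* (c⁻¹ :* x)) refl c c⁻¹ x)
                             (inverse-cancel cc⁻¹≡1 x)
      solution : ∀ {x} → F (x + a) - F x ≡ b → D (c⁻¹ * x - 1#) ≡ (c⁻¹ * c⁻¹) * (- b)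
      solution {x} Fx+a-Fx≡b = unscale cc⁻¹≡1 (begin
        (c * c) * D (c⁻¹ * x - 1#)                          ≡⟨ D-homogeneous ηc≡1 (c⁻¹ * x - 1#) ⟩
        F (c * (c⁻¹ * x - 1#) + c) - F (c * (c⁻¹ * x - 1#))  ≡⟨ cong₂ (λ s t → F s - F t) (shifted-back x) (shifted x) ⟩
        F x - F (x + a)                                     ≡⟨ solve 2 (λ p q → p :- q := :- (q :- p)) refl (F x) (F (x + a)) ⟩
        - (F (x + a) - F x)                                 ≡⟨ cong -_ Fx+a-Fx≡b ⟩
        - b                                                 ∎)

  -- Writing a = ± c with η c = 1, the substitution x = c y (or x = c (y + 1)) turns the
  -- difference in direction a into ± c² times the difference in direction 1.
  δ≤δ₁ : ∀ {a} → a ≢ 0# → ∀ b → ∃ λ b′ → δ K F a b ≤ δ₁ b′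
  δ≤δ₁ {a} a≢0 b with η-≢0 a≢0
  ... | inj₁ ηa≡1  = δ≤δ₁-square ηa≡1 (inverse a a≢0) b
  ... | inj₂ ηa≡-1 = δ≤δ₁-nonsquare (trans (η-neg a) (cong ℤ.-_ ηa≡-1)) (inverse (- a) (-x≢0 a≢0)) b

  δmax≤ : ∀ {k} → (∀ b → δ₁ b ≤ k) → δmax K F ≤ k
  δmax≤ {k} δ₁≤k = foldr-preservesᵇ {P = _≤ k} ℕ.⊔-lub z≤n (map⁺ (All.map bound-at (all-filter (λ a → ¬? (a ≟ 0#)) elems)))
    where
    bound-at : ∀ {a} → a ≢ 0# → foldr ℕ._⊔_ 0 (map (δ K F a) elems) ≤ k
    bound-at a≢0 = foldr-preservesᵇ {P = _≤ k} ℕ.⊔-lub z≤n (map⁺ {xs = elems} (All.tabulate λ {b} _ →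
      let b′ , δ≤ = δ≤δ₁ a≢0 b in ℕ.≤-trans δ≤ (δ₁≤k b′)))

corollary1 : (K : FiniteField) (p n : ℕ) → Prime p → p ≢ 2 →
    FiniteField.card K ≡ p ^ n → FiniteField.card K % 4 ≡ 3 →
    (u : FiniteField.Carrier K) →
    u ≢ FiniteField.0# K → u ≢ FiniteField.1# K →
    u ≢ FiniteField.-_ K (FiniteField.1# K) →
    let open FiniteField K in
    (δmax K (F2 K u) ≤ 5)
    × (η K (1# + u) ≡ η K (1# - u) → δmax K (F2 K u) ≤ 4)
    × (η K (1# + u) ≡ η K (u - 1#) → η K (u - 1#) ≡ η K u →
        (b : Carrier) → (δ K (F2 K u) 1# b ≡ 5) ⇔
          ((#A K u 0 0 b ≡ 1) × (#A K u 1 1 b ≡ 1) × (#A K u 1 0 b ≡ 1) × (#A K u 0 1 b ≡ 2)))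
    × (η K (1# + u) ≡ η K (u - 1#) → η K (u - 1#) ≡ ℤ.- η K u →
        (b : Carrier) → (δ K (F2 K u) 1# b ≡ 5) ⇔
          ((#A K u 0 0 b ≡ 1) × (#A K u 1 1 b ≡ 1) × (#A K u 0 1 b ≡ 1) × (#A K u 1 0 b ≡ 2)))
-- Only q ≡ 3 (mod 4) is used: K is given as a field.
corollary1 K _ _ _ _ _ card%4≡3 u u≢0 u≢1 u≢-1 =
  δmax≤ δ₁≤5 , (λ η₊≡η₋ → δmax≤ (δ₁≤4 η₊≡η₋)) , δ₁≡5-case₂ , δ₁≡5-case₃
  where open DifferentialUniformity K card%4≡3 u u≢0 u≢1 u≢-1
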